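{- Let $\mu,\nu,q\in\mathbb{C}$ and let $X,Y$ be the generators of the $q$-deformed generalized Ore algebra $\mathcal{O}_{\mu,\nu}(q)$. Let $\omega=Y^{n_r}X^{m_r}\cdots Y^{n_1}X^{m_1}$ with $n_j,m_j\in\mathbb{N}_0$, and put $|\mathbf{n}|=n_1+\cdots+n_r$, $|\mathbf{m}|=m_1+\cdots+m_r$. Then in $\mathcal{O}_{\mu,\nu}(q)$ $$\omega=\sum_{k=0}^{\min(|\mathbf{m}|,|\mathbf{n}|)}\ \sum_{\ell=0}^{|\mathbf{m}|-k} m_{k,\ell}(B_\omega;q)\,Y^{|\mathbf{n}|-k}X^{|\mathbf{m}|-k-\ell}.$$
   Context: $\mathcal{O}_{\mu,\nu}(q)$ is the complex unital algebra generated by $X,Y$ subject to $XY-qYX=\mu I+\nu Y$. Board of a word: for a word $\omega$ in $X,Y$, draw the lattice path starting at $(0,0)$ reading $\omega$ from left to right, each $X$ a unit step right and each $Y$ a unit step up. $B_\omega$ is the Ferrers board of unit cells lying above this path, with $x\ge 0$ and below the line $y=$ (number of $Y$'s in $\omega$). Equivalently, columns correspond to the letters $X$ (left to right), rows to the letters $Y$ (the $j$-th $Y$ from the left is the $j$-th row from the bottom), and the column of a given $X$ contains a cell in the row of each $Y$ occurring to the right of that $X$. "Above" means in a higher row. Mixed placements: for a Ferrers board $B$, $\mathcal{M}_{k,\ell}(B)$ is the set of placements of $k$ rooks and $\ell$ files in distinct cells of $B$ which are non-attacking, meaning: no two rooks lie in the same row or column; no two files lie in the same column; no file and rook lie in the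 same column; and no file lies in the same row as a rook and to the left of it. For $\phi\in\mathcal{M}_{k,\ell}(B)$, a cell is a rook box (resp. file box) if it contains a rook (resp. file); it is cancelled if it is neither and it lies above a rook in the same column, or to the left of a rook in the same row, or above a file in the same column; all other cells are empty boxes. The $q$-deformed mixed placement numbers are $$m_{k,\ell}(B;q)=\mu^k\nu^\ell\sum_{\phi\in\mathcal{M}_{k,\ell}(B)}q^{\#\text{empty boxes of }\phi}$$ (the empty placement contributes $q^{|B|}$, $|B|$ the number of cells). -}

module Defs where

open import Level using (Level)
open import Data.Bool using (Bool; true; false; _∧_; _∨_; not; if_then_else_)
open import Data.Nat using (ℕ; zero; suc; _≡ᵇ_; _<ᵇ_; _∸_)
open import Data.Fin using (Fin; toℕ)
open import Data.Product using (_×_; _,_)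
open import Data.List using (List; []; _∷_; _++_; length; map; concatMap; allFin;
  cartesianProduct; replicate; foldr)
open import Data.Bool.ListAction using (all; any)
import Data.List as L
open import Data.Vec using (Vec; []; _∷_)
import Data.Vec as V
open import Algebra.Bundles using (Ring)

data Letter : Set where
  𝕏 𝕐 : Letter

isX isY : Letter → Bool
isX 𝕏 = true
isX 𝕐 = false
isY l = not (isX l)

-- ω = Y^{n_r} X^{m_r} ⋯ Y^{n_1} X^{m_1}; the head of the vectors is
-- (n_1, m_1), i.e. the rightmost block of the word.
blockWord : ∀ {r} → Vec ℕ r → Vec ℕ r → List Letter
blockWord [] [] = []
blockWord (n ∷ ns) (m ∷ ms) = blockWord ns ms ++ (replicate n 𝕐 ++ replicate m 𝕏)

positionsFrom : ℕ → (Letter → Bool) → List Letter → List ℕ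
positionsFrom i p [] = []
positionsFrom i p (l ∷ w) =
  if p l then i ∷ positionsFrom (suc i) p w else positionsFrom (suc i) p w

xPos yPos : List Letter → List ℕ
xPos = positionsFrom 0 isX
yPos = positionsFrom 0 isY

#X #Y : List Letter → ℕ
#X w = length (xPos w)
#Y w = length (yPos w)

-- The board B_ω: column c (the c-th X from the left, 0-based) and row ρ
-- (the ρ-th Y from the left = ρ-th row from the bottom, 0-based).

inBoard : (w : List Letter) → Fin (#X w) → Fin (#Y w) → Bool
inBoard w c ρ = L.lookup (xPos w) c <ᵇ L.lookup (yPos w) ρ

data Content : Set where
  none rook file : Content

isNone isRook isFile : Content → Bool
isNone none = true
isNone _    = false
isRook rook = true
isRook _    = false
isFile file = true
isFile _    = false

Placement : ℕ → ℕ → Set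
Placement a b = Vec (Vec Content b) a

at : ∀ {a b} → Placement a b → Fin a → Fin b → Content
at φ c ρ = V.lookup (V.lookup φ c) ρ

allVecs : ∀ {A : Set} (n : ℕ) → List A → List (Vec A n)
allVecs zero    xs = [] ∷ []
allVecs (suc n) xs = concatMap (λ x → map (x ∷_) (allVecs n xs)) xs

allPlacements : (a b : ℕ) → List (Placement a b)
allPlacements a b = allVecs a (allVecs b (none ∷ rook ∷ file ∷ []))

_==_ : ∀ {n} → Fin n → Fin n → Bool
i == j = toℕ i ≡ᵇ toℕ j

_<ᶠ_ : ∀ {n} → Fin n → Fin n → Bool
i <ᶠ j = toℕ i <ᵇ toℕ j

cells : (a b : ℕ) → List (Fin a × Fin b)
cells a b = cartesianProduct (allFin a) (allFin b)

countB : ∀ {A : Set} → (A → Bool) → List A → ℕ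
countB p [] = 0
countB p (x ∷ xs) = if p x then suc (countB p xs) else countB p xs

filterB : ∀ {A : Set} → (A → Bool) → List A → List A
filterB p [] = []
filterB p (x ∷ xs) = if p x then x ∷ filterB p xs else filterB p xs

module MixedPlacements {a b : ℕ} (inB : Fin a → Fin b → Bool) where

  supported : Placement a b → Bool
  supported φ = all (λ { (c , ρ) → inB c ρ ∨ isNone (at φ c ρ) }) (cells a b)

  pairOK : Placement a b → (Fin a × Fin b) → (Fin a × Fin b) → Bool
  pairOK φ (c , ρ) (c' , ρ') =
    (c == c' ∧ ρ == ρ') ∨
    ( (not (isRook x ∧ isRook y) ∨ (not (c == c') ∧ not (ρ == ρ')))
    ∧ (not (isFile x ∧ isFile y) ∨ not (c == c'))
    ∧ (not (isFile x ∧ isRook y) ∨ (not (c == c') ∧ not (ρ == ρ' ∧ c <ᶠ c'))))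
    where
      x = at φ c ρ
      y = at φ c' ρ'

  nonAttacking : Placement a b → Bool
  nonAttacking φ = all (λ p → all (pairOK φ p) (cells a b)) (cells a b)

  #rooks #files : Placement a b → ℕ
  #rooks φ = countB (λ { (c , ρ) → isRook (at φ c ρ) }) (cells a b)
  #files φ = countB (λ { (c , ρ) → isFile (at φ c ρ) }) (cells a b)

  mixed : ℕ → ℕ → List (Placement a b)
  mixed k ℓ = filterB (λ φ → supported φ ∧ nonAttacking φ ∧ (#rooks φ ≡ᵇ k) ∧ (#files φ ≡ᵇ ℓ))
                      (allPlacements a b)

  cancelled : Placement a b → Fin a → Fin b → Bool
  cancelled φ c ρ = isNone (at φ c ρ) ∧
    ( any (λ ρ' → ρ' <ᶠ ρ ∧ isRook (at φ c ρ')) (allFin b)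
    ∨ any (λ c' → c <ᶠ c' ∧ isRook (at φ c' ρ)) (allFin a)
    ∨ any (λ ρ' → ρ' <ᶠ ρ ∧ isFile (at φ c ρ')) (allFin b))

  #empty : Placement a b → ℕ
  #empty φ = countB (λ { (c , ρ) → inB c ρ ∧ isNone (at φ c ρ) ∧ not (cancelled φ c ρ) })
                    (cells a b)

module RingDefs {c ℓ' : Level} (R : Ring c ℓ') where
  open Ring R

  infixr 8 _^ᴿ_
  _^ᴿ_ : Carrier → ℕ → Carrier
  x ^ᴿ zero  = 1#
  x ^ᴿ suc n = x * (x ^ᴿ n)

  sumᴿ : List Carrier → Carrier
  sumᴿ = foldr _+_ 0#

  Σ≤ : ℕ → (ℕ → Carrier) → Carrier
  Σ≤ zero    f = f 0
  Σ≤ (suc N) f = Σ≤ N f + f (suc N)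

  evalLetter : Carrier → Carrier → Letter → Carrier
  evalLetter X Y 𝕏 = X
  evalLetter X Y 𝕐 = Y

  evalWord : Carrier → Carrier → List Letter → Carrier
  evalWord X Y w = foldr (λ l r → evalLetter X Y l * r) 1# w

  mkl : (μ ν q : Carrier) → List Letter → ℕ → ℕ → Carrier
  mkl μ ν q w k l = (μ ^ᴿ k) * (ν ^ᴿ l) *
    sumᴿ (map (λ φ → q ^ᴿ #empty φ) (mixed k l))
    where open MixedPlacements (inBoard w)

module Submission where

open import Defs
open import Level using (Level)
open import Data.Nat using (ℕ; _⊓_; _∸_)
open import Data.Vec using (Vec; sum)
open import Algebra.Bundles using (Ring)
open import Relation.Binary.PropositionalEquality using (subst₂)

-- Write F(B) for the placement sum
--   Σ_φ μ^#rooks ν^#files q^#empty Y^(#rows - #rooks) X^(#columns - #rooks - #files)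
-- over the admissible placements φ of a board B, and read the word from the left.
-- Prepending Y to ω adds an empty bottom row to B_ω (no X precedes that Y), which only
-- raises the exponent of Y: F(B_Yω) = Y F(B_ω).  Prepending X adds a full leftmost column.
-- If the placement to its right leaves N rows free of rooks, the new column either stays
-- empty (its N free cells are empty boxes, weight q^N) or holds one rook or file in a free
-- row (the free cells below it are empty, all others cancelled; together 1 + q + ⋯ + q^(N-1)).
-- This is exactly the commutation rule X Y^N = q^N Y^N X + [N]_q (μ Y^(N-1) + ν Y^N), so
-- F(B_Xω) = X F(B_ω).  Hence ω = F(B_ω), and grouping the placements by their numbers of
-- rooks and files gives the normal form.

module BooleanFolds where

  open import Function using (_∘_)
  open import Data.Bool using (Bool; true; false; _∧_; _∨_; not; if_then_else_)
  open import Data.Bool.Properties using (∧-conicalˡ; ∧-conicalʳ; ∨-zeroʳ)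
  open import Data.Bool.ListAction using (all; any)
  open import Data.Nat using (zero; suc; _+_; _≤_; _<_; z≤n; s≤s; _≡ᵇ_; _<ᵇ_)
  open import Data.Fin using (Fin; zero; suc; toℕ)
  open import Data.Fin.Properties using (toℕ-injective)
  open import Data.Product using (_×_; _,_)
  open import Data.List using (List; []; _∷_; _++_; map; tabulate; cartesianProduct)
  open import Data.List.Properties using (map-tabulate)
  open import Relation.Binary.PropositionalEquality
  open import Data.Empty using (⊥-elim)

  ∧-intro : ∀ {x y} → x ≡ true → y ≡ true → x ∧ y ≡ true
  ∧-intro refl refl = refl

  true⇔true⇒≡ : ∀ {x y} → (x ≡ true → y ≡ true) → (y ≡ true → x ≡ true) → x ≡ y
  true⇔true⇒≡ {false} {false} _ _ = refl
  true⇔true⇒≡ {false} {true}  _ g = g refl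
  true⇔true⇒≡ {true}  f _ = sym (f refl)

  ∨-introˡ : ∀ {x} y → x ≡ true → x ∨ y ≡ true
  ∨-introˡ y refl = refl

  ∨-introʳ : ∀ x {y} → y ≡ true → x ∨ y ≡ true
  ∨-introʳ x refl = ∨-zeroʳ x

  ∧-elim : ∀ {x y} → x ∧ y ≡ true → x ≡ true × y ≡ true
  ∧-elim {x} {y} h = ∧-conicalˡ x y h , ∧-conicalʳ x y h

  ∧-not-∧-true : ∀ x {y} → y ≡ true → x ∧ not (x ∧ y) ≡ false
  ∧-not-∧-true true  refl = refl
  ∧-not-∧-true false _    = refl

  ≡ᵇ-refl : ∀ m → (m ≡ᵇ m) ≡ true
  ≡ᵇ-refl zero    = refl
  ≡ᵇ-refl (suc m) = ≡ᵇ-refl m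

  ≡ᵇ-≢ : ∀ {m n} → m ≢ n → (m ≡ᵇ n) ≡ false
  ≡ᵇ-≢ {zero}  {zero}  m≢n = ⊥-elim (m≢n refl)
  ≡ᵇ-≢ {zero}  {suc n} _   = refl
  ≡ᵇ-≢ {suc m} {zero}  _   = refl
  ≡ᵇ-≢ {suc m} {suc n} m≢n = ≡ᵇ-≢ (m≢n ∘ cong suc)

  <⇒<ᵇ≡true : ∀ {m n} → m < n → (m <ᵇ n) ≡ true
  <⇒<ᵇ≡true {zero}  (s≤s _)   = refl
  <⇒<ᵇ≡true {suc m} (s≤s m<n) = <⇒<ᵇ≡true m<n

  ≤⇒<ᵇ≡false : ∀ {m n} → n ≤ m → (m <ᵇ n) ≡ false
  ≤⇒<ᵇ≡false {zero}  z≤n       = refl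
  ≤⇒<ᵇ≡false {suc m} z≤n       = refl
  ≤⇒<ᵇ≡false         (s≤s n≤m) = ≤⇒<ᵇ≡false n≤m

  ==-refl : ∀ {n} (i : Fin n) → (i == i) ≡ true
  ==-refl i = ≡ᵇ-refl (toℕ i)

  ==-≢ : ∀ {n} {i j : Fin n} → i ≢ j → (i == j) ≡ false
  ==-≢ i≢j = ≡ᵇ-≢ (i≢j ∘ toℕ-injective)

  -- Unlike all, any and countB over allFin, these folds unfold definitionally on Fin (suc n).
  allᶠ anyᶠ : ∀ {n} → (Fin n → Bool) → Bool
  allᶠ {zero}  p = true
  allᶠ {suc n} p = p zero ∧ allᶠ (λ i → p (suc i))
  anyᶠ {zero}  p = false
  anyᶠ {suc n} p = p zero ∨ anyᶠ (λ i → p (suc i))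

  countᶠ : ∀ {n} → (Fin n → Bool) → ℕ
  countᶠ {zero}  p = 0
  countᶠ {suc n} p = if p zero then suc (countᶠ (λ i → p (suc i))) else countᶠ (λ i → p (suc i))

  sumᶠ : ∀ {n} → (Fin n → ℕ) → ℕ
  sumᶠ {zero}  s = 0
  sumᶠ {suc n} s = s zero + sumᶠ (λ i → s (suc i))

  allᶠ⁺ : ∀ {n} {p : Fin n → Bool} → (∀ i → p i ≡ true) → allᶠ p ≡ true
  allᶠ⁺ {zero}  h = refl
  allᶠ⁺ {suc n} h = ∧-intro (h zero) (allᶠ⁺ (h ∘ suc))

  allᶠ⁻ : ∀ {n} {p : Fin n → Bool} → allᶠ p ≡ true → ∀ i → p i ≡ true
  allᶠ⁻ {suc n} {p} h zero    = ∧-conicalˡ (p zero) _ h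
  allᶠ⁻ {suc n} {p} h (suc i) = allᶠ⁻ (∧-conicalʳ (p zero) _ h) i

  allᶠ-cong : ∀ {n} {p p' : Fin n → Bool} → (∀ i → p i ≡ p' i) → allᶠ p ≡ allᶠ p'
  allᶠ-cong {zero}  h = refl
  allᶠ-cong {suc n} h = cong₂ _∧_ (h zero) (allᶠ-cong (h ∘ suc))

  anyᶠ-cong : ∀ {n} {p p' : Fin n → Bool} → (∀ i → p i ≡ p' i) → anyᶠ p ≡ anyᶠ p'
  anyᶠ-cong {zero}  h = refl
  anyᶠ-cong {suc n} h = cong₂ _∨_ (h zero) (anyᶠ-cong (h ∘ suc))

  countᶠ-cong : ∀ {n} {p p' : Fin n → Bool} → (∀ i → p i ≡ p' i) → countᶠ p ≡ countᶠ p'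
  countᶠ-cong {zero}  h = refl
  countᶠ-cong {suc n} h rewrite h zero | countᶠ-cong (h ∘ suc) = refl

  sumᶠ-cong : ∀ {n} {s s' : Fin n → ℕ} → (∀ i → s i ≡ s' i) → sumᶠ s ≡ sumᶠ s'
  sumᶠ-cong {zero}  h = refl
  sumᶠ-cong {suc n} h = cong₂ _+_ (h zero) (sumᶠ-cong (h ∘ suc))

  anyᶠ-false : ∀ n → anyᶠ {n} (λ _ → false) ≡ false
  anyᶠ-false zero    = refl
  anyᶠ-false (suc n) = anyᶠ-false n

  countᶠ-false : ∀ {n} {p : Fin n → Bool} → (∀ i → p i ≡ false) → countᶠ p ≡ 0
  countᶠ-false {zero}  h = refl
  countᶠ-false {suc n} h rewrite h zero = countᶠ-false (h ∘ suc)

  countᶠ-true : ∀ n → countᶠ {n} (λ _ → true) ≡ n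
  countᶠ-true zero    = refl
  countᶠ-true (suc n) = cong suc (countᶠ-true n)

  ∨-allᶠ⁺ : ∀ {n} x {p : Fin n → Bool} → (∀ i → x ∨ p i ≡ true) → x ∨ allᶠ p ≡ true
  ∨-allᶠ⁺ true  h = refl
  ∨-allᶠ⁺ false h = allᶠ⁺ h

  ∨-allᶠ⁻ : ∀ {n} x {p : Fin n → Bool} → x ∨ allᶠ p ≡ true → ∀ i → x ∨ p i ≡ true
  ∨-allᶠ⁻ true  h i = refl
  ∨-allᶠ⁻ false h i = allᶠ⁻ h i

  not-anyᶠ : ∀ {n} (p : Fin n → Bool) → not (anyᶠ p) ≡ allᶠ (not ∘ p)
  not-anyᶠ {zero}  p = refl
  not-anyᶠ {suc n} p with p zero
  ... | true  = refl
  ... | false = not-anyᶠ (p ∘ suc)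

  countᶠ-falseHead : ∀ {n} {p : Fin (suc n) → Bool} → p zero ≡ false → countᶠ p ≡ countᶠ (p ∘ suc)
  countᶠ-falseHead h rewrite h = refl

  module _ {A : Set} (h : A → Bool) where

    all-++ : ∀ xs ys → all h (xs ++ ys) ≡ all h xs ∧ all h ys
    all-++ []       ys = refl
    all-++ (x ∷ xs) ys rewrite all-++ xs ys with h x
    ... | true  = refl
    ... | false = refl

    countB-++ : ∀ xs ys → countB h (xs ++ ys) ≡ countB h xs + countB h ys
    countB-++ []       ys = refl
    countB-++ (x ∷ xs) ys with h x
    ... | true  = cong suc (countB-++ xs ys)
    ... | false = countB-++ xs ys

    all-tabulate : ∀ {n} (f : Fin n → A) → all h (tabulate f) ≡ allᶠ (h ∘ f)
    all-tabulate {zero}  f = refl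
    all-tabulate {suc n} f = cong (h (f zero) ∧_) (all-tabulate (f ∘ suc))

    any-tabulate : ∀ {n} (f : Fin n → A) → any h (tabulate f) ≡ anyᶠ (h ∘ f)
    any-tabulate {zero}  f = refl
    any-tabulate {suc n} f = cong (h (f zero) ∨_) (any-tabulate (f ∘ suc))

    countB-tabulate : ∀ {n} (f : Fin n → A) → countB h (tabulate f) ≡ countᶠ (h ∘ f)
    countB-tabulate {zero}  f = refl
    countB-tabulate {suc n} f with h (f zero)
    ... | true  = cong suc (countB-tabulate (f ∘ suc))
    ... | false = countB-tabulate (f ∘ suc)

  module _ {A B : Set} (h : A × B → Bool) where

    all-cartesianProduct : ∀ {m n} (f : Fin m → A) (g : Fin n → B) →
      all h (cartesianProduct (tabulate f) (tabulate g)) ≡ allᶠ λ i → allᶠ λ j → h (f i , g j)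
    all-cartesianProduct {zero}  f g = refl
    all-cartesianProduct {suc m} f g = begin
      all h (map (f zero ,_) (tabulate g) ++ cartesianProduct (tabulate (f ∘ suc)) (tabulate g))
        ≡⟨ all-++ h (map (f zero ,_) (tabulate g)) _ ⟩
      all h (map (f zero ,_) (tabulate g)) ∧ all h (cartesianProduct (tabulate (f ∘ suc)) (tabulate g))
        ≡⟨ cong₂ _∧_ (trans (cong (all h) (map-tabulate g (f zero ,_))) (all-tabulate h (λ j → f zero , g j)))
                     (all-cartesianProduct (f ∘ suc) g) ⟩
      (allᶠ λ i → allᶠ λ j → h (f i , g j)) ∎
      where open ≡-Reasoning

    countB-cartesianProduct : ∀ {m n} (f : Fin m → A) (g : Fin n → B) →
      countB h (cartesianProduct (tabulate f) (tabulate g)) ≡ sumᶠ λ i → countᶠ λ j → h (f i , g j)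
    countB-cartesianProduct {zero}  f g = refl
    countB-cartesianProduct {suc m} f g = begin
      countB h (map (f zero ,_) (tabulate g) ++ cartesianProduct (tabulate (f ∘ suc)) (tabulate g))
        ≡⟨ countB-++ h (map (f zero ,_) (tabulate g)) _ ⟩
      countB h (map (f zero ,_) (tabulate g)) + countB h (cartesianProduct (tabulate (f ∘ suc)) (tabulate g))
        ≡⟨ cong₂ _+_ (trans (cong (countB h) (map-tabulate g (f zero ,_))) (countB-tabulate h (λ j → f zero , g j)))
                     (countB-cartesianProduct (f ∘ suc) g) ⟩
      (sumᶠ λ i → countᶠ λ j → h (f i , g j)) ∎
      where open ≡-Reasoning

module Placements where

  open import Function using (_∘_)
  open import Data.Bool using (Bool; true; false; _∧_; _∨_; not; if_then_else_)
  open import Data.Bool.Properties using (∧-assoc; ∨-zeroʳ; ∨-identityʳ)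
  open import Data.Bool.ListAction using (all)
  open import Data.Nat using (zero; suc; _+_; _≤_; z≤n)
  import Data.Nat.Properties as ℕ
  open import Algebra.Properties.CommutativeSemigroup ℕ.+-commutativeSemigroup using (interchange)
  open import Data.Fin using (Fin; zero; suc)
  open import Data.Fin.Properties using (_≟_; suc-injective)
  open import Data.Product using (_×_; _,_; proj₁; proj₂)
  open import Data.Vec using ([]; _∷_; lookup)
  open import Relation.Binary.PropositionalEquality
  open import Relation.Nullary using (yes; no)
  open import Data.Empty using (⊥-elim)
  open BooleanFolds

  isNone⇒≡none : ∀ {x} → isNone x ≡ true → x ≡ none
  isNone⇒≡none {none} _ = refl

  Board : ℕ → ℕ → Set
  Board a b = Fin a → Fin b → Bool

  Array : ℕ → ℕ → Set
  Array a b = Fin a → Fin b → Content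

  -- pairOK of Defs, with the three comparisons between the two cells abstracted.
  compatible : Content → Content → (sameColumn sameRow leftOf : Bool) → Bool
  compatible x y sc sr lt =
    (sc ∧ sr) ∨
    ( (not (isRook x ∧ isRook y) ∨ (not sc ∧ not sr))
    ∧ (not (isFile x ∧ isFile y) ∨ not sc)
    ∧ (not (isFile x ∧ isRook y) ∨ (not sc ∧ not (sr ∧ lt))))

  module _ {a b : ℕ} where

    supportedᴬ : Board a b → Array a b → Bool
    supportedᴬ inB A = allᶠ λ c → allᶠ λ ρ → inB c ρ ∨ isNone (A c ρ)

    compatibleAt : Array a b → Fin a → Fin b → Fin a → Fin b → Bool
    compatibleAt A c ρ c' ρ' = compatible (A c ρ) (A c' ρ') (c == c') (ρ == ρ') (c <ᶠ c')

    nonAttackingᴬ : Array a b → Bool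
    nonAttackingᴬ A = allᶠ λ c → allᶠ λ ρ → allᶠ λ c' → allᶠ λ ρ' → compatibleAt A c ρ c' ρ'

    admissible : Board a b → Array a b → Bool
    admissible inB A = supportedᴬ inB A ∧ nonAttackingᴬ A

    #rooksᴬ #filesᴬ : Array a b → ℕ
    #rooksᴬ A = sumᶠ λ c → countᶠ λ ρ → isRook (A c ρ)
    #filesᴬ A = sumᶠ λ c → countᶠ λ ρ → isFile (A c ρ)

    cancelledᴬ : Array a b → Fin a → Fin b → Bool
    cancelledᴬ A c ρ = isNone (A c ρ) ∧
      ( anyᶠ (λ ρ' → ρ' <ᶠ ρ ∧ isRook (A c ρ'))
      ∨ anyᶠ (λ c' → c <ᶠ c' ∧ isRook (A c' ρ))
      ∨ anyᶠ (λ ρ' → ρ' <ᶠ ρ ∧ isFile (A c ρ')))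

    #emptyᴬ : Board a b → Array a b → ℕ
    #emptyᴬ inB A = sumᶠ λ c → countᶠ λ ρ → inB c ρ ∧ isNone (A c ρ) ∧ not (cancelledᴬ A c ρ)

    rookFree : Array a b → Fin b → Bool
    rookFree A ρ = allᶠ λ c → not (isRook (A c ρ))

    nonAttackingᴬ⁺ : {A : Array a b} → (∀ c ρ c' ρ' → compatibleAt A c ρ c' ρ' ≡ true) → nonAttackingᴬ A ≡ true
    nonAttackingᴬ⁺ h = allᶠ⁺ λ c → allᶠ⁺ λ ρ → allᶠ⁺ λ c' → allᶠ⁺ λ ρ' → h c ρ c' ρ'

    nonAttackingᴬ⁻ : {A : Array a b} → nonAttackingᴬ A ≡ true → ∀ c ρ c' ρ' → compatibleAt A c ρ c' ρ' ≡ true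
    nonAttackingᴬ⁻ h c ρ c' ρ' = allᶠ⁻ (allᶠ⁻ (allᶠ⁻ (allᶠ⁻ h c) ρ) c') ρ'

  module _ {a b : ℕ} (inB : Board a b) (φ : Placement a b) where
    open MixedPlacements inB

    supported-at : supported φ ≡ supportedᴬ inB (at φ)
    supported-at =
      all-cartesianProduct (λ p → inB (proj₁ p) (proj₂ p) ∨ isNone (at φ (proj₁ p) (proj₂ p))) (λ c → c) (λ ρ → ρ)

    nonAttacking-at : nonAttacking φ ≡ nonAttackingᴬ (at φ)
    nonAttacking-at = trans (all-cartesianProduct (λ p → all (pairOK φ p) (cells a b)) (λ c → c) (λ ρ → ρ))
      (allᶠ-cong λ c → allᶠ-cong λ ρ → all-cartesianProduct (pairOK φ (c , ρ)) (λ c → c) (λ ρ → ρ))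

    #rooks-at : #rooks φ ≡ #rooksᴬ (at φ)
    #rooks-at = countB-cartesianProduct (λ p → isRook (at φ (proj₁ p) (proj₂ p))) (λ c → c) (λ ρ → ρ)

    #files-at : #files φ ≡ #filesᴬ (at φ)
    #files-at = countB-cartesianProduct (λ p → isFile (at φ (proj₁ p) (proj₂ p))) (λ c → c) (λ ρ → ρ)

    cancelled-at : ∀ c ρ → cancelled φ c ρ ≡ cancelledᴬ (at φ) c ρ
    cancelled-at c ρ = cong (isNone (at φ c ρ) ∧_)
      (cong₂ _∨_ (any-tabulate (λ ρ' → ρ' <ᶠ ρ ∧ isRook (at φ c ρ')) (λ ρ → ρ))
        (cong₂ _∨_ (any-tabulate (λ c' → c <ᶠ c' ∧ isRook (at φ c' ρ)) (λ c → c))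
                   (any-tabulate (λ ρ' → ρ' <ᶠ ρ ∧ isFile (at φ c ρ')) (λ ρ → ρ))))

    #empty-at : #empty φ ≡ #emptyᴬ inB (at φ)
    #empty-at = trans
      (countB-cartesianProduct (λ p → inB (proj₁ p) (proj₂ p) ∧ isNone (at φ (proj₁ p) (proj₂ p))
                                        ∧ not (cancelled φ (proj₁ p) (proj₂ p))) (λ c → c) (λ ρ → ρ))
      (sumᶠ-cong λ c → countᶠ-cong λ ρ → cong (λ z → inB c ρ ∧ isNone (at φ c ρ) ∧ not z) (cancelled-at c ρ))

  compatible-noneˡ : ∀ y sc sr lt → compatible none y sc sr lt ≡ true
  compatible-noneˡ y sc sr lt = ∨-zeroʳ (sc ∧ sr)

  compatible-noneʳ : ∀ x sc sr lt → compatible x none sc sr lt ≡ true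
  compatible-noneʳ none sc sr lt = ∨-zeroʳ (sc ∧ sr)
  compatible-noneʳ rook sc sr lt = ∨-zeroʳ (sc ∧ sr)
  compatible-noneʳ file sc sr lt = ∨-zeroʳ (sc ∧ sr)

  compatible-sameCell : ∀ x y {sr} lt → sr ≡ true → compatible x y true sr lt ≡ true
  compatible-sameCell x y lt refl = refl

  compatible-otherLines : ∀ x y {sr} lt → sr ≡ false → compatible x y false sr lt ≡ true
  compatible-otherLines none y    lt refl = refl
  compatible-otherLines rook none lt refl = refl
  compatible-otherLines rook rook lt refl = refl
  compatible-otherLines rook file lt refl = refl
  compatible-otherLines file none lt refl = refl
  compatible-otherLines file rook lt refl = refl
  compatible-otherLines file file lt refl = refl

  compatible-sameColumn⁺ : ∀ x y {sr} lt → sr ≡ false → isNone x ∨ isNone y ≡ true →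
    compatible x y true sr lt ≡ true
  compatible-sameColumn⁺ none y    lt refl _ = refl
  compatible-sameColumn⁺ rook none lt refl _ = refl
  compatible-sameColumn⁺ file none lt refl _ = refl

  compatible-sameColumn⁻ : ∀ x y {sr sr'} → sr ≡ false → sr' ≡ false →
    compatible x y true sr false ≡ true → compatible y x true sr' false ≡ true → isNone x ∨ isNone y ≡ true
  compatible-sameColumn⁻ none y    refl refl _ _ = refl
  compatible-sameColumn⁻ rook none refl refl _ _ = refl
  compatible-sameColumn⁻ file none refl refl _ _ = refl

  compatible-leftInRow⁺ : ∀ x y {sr} → sr ≡ true → isNone x ∨ not (isRook y) ≡ true →
    compatible x y false sr true ≡ true
  compatible-leftInRow⁺ none y    refl _ = refl
  compatible-leftInRow⁺ rook none refl _ = refl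
  compatible-leftInRow⁺ rook file refl _ = refl
  compatible-leftInRow⁺ file none refl _ = refl
  compatible-leftInRow⁺ file file refl _ = refl

  compatible-leftInRow⁻ : ∀ x y {sr} → sr ≡ true → compatible x y false sr true ≡ true →
    isNone x ∨ not (isRook y) ≡ true
  compatible-leftInRow⁻ none y    refl _ = refl
  compatible-leftInRow⁻ rook none refl _ = refl
  compatible-leftInRow⁻ rook file refl _ = refl
  compatible-leftInRow⁻ file none refl _ = refl
  compatible-leftInRow⁻ file file refl _ = refl

  compatible-rightInRow⁺ : ∀ x y {sr} → sr ≡ true → isNone y ∨ not (isRook x) ≡ true →
    compatible x y false sr false ≡ true
  compatible-rightInRow⁺ none y    refl _ = refl
  compatible-rightInRow⁺ rook none refl _ = refl
  compatible-rightInRow⁺ file none refl _ = refl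
  compatible-rightInRow⁺ file rook refl _ = refl
  compatible-rightInRow⁺ file file refl _ = refl

  noPieces : ∀ {b} → Vec Content b → Bool
  noPieces col = allᶠ λ ρ → isNone (lookup col ρ)

  #rooksᶜ #filesᶜ : ∀ {b} → Vec Content b → ℕ
  #rooksᶜ col = countᶠ λ ρ → isRook (lookup col ρ)
  #filesᶜ col = countᶠ λ ρ → isFile (lookup col ρ)

  -- A new leftmost column, beside columns whose rook-free rows are given by free, is admissible
  -- iff it holds at most one piece, in a free row; its empty boxes are the free cells below that
  -- piece (the others are cancelled, lying above the piece or left of a rook).
  columnOK : ∀ {b} → Vec Content b → (Fin b → Bool) → Bool
  columnOK []           free = true
  columnOK (none ∷ col) free = columnOK col (free ∘ suc)
  columnOK (rook ∷ col) free = free zero ∧ noPieces col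
  columnOK (file ∷ col) free = free zero ∧ noPieces col

  #emptyᶜ : ∀ {b} → Vec Content b → (Fin b → Bool) → ℕ
  #emptyᶜ []           free = 0
  #emptyᶜ (none ∷ col) free = if free zero then suc (#emptyᶜ col (free ∘ suc)) else #emptyᶜ col (free ∘ suc)
  #emptyᶜ (rook ∷ col) free = 0
  #emptyᶜ (file ∷ col) free = 0

  module _ {b : ℕ} where

    AtMostOnePiece : Vec Content b → Set
    AtMostOnePiece col = ∀ {ρ ρ'} → ρ ≢ ρ' → isNone (lookup col ρ) ∨ isNone (lookup col ρ') ≡ true

    PiecesIn : (Fin b → Bool) → Vec Content b → Set
    PiecesIn free col = ∀ ρ → isNone (lookup col ρ) ∨ free ρ ≡ true

  noPieces⇒#rooksᶜ≡0 : ∀ {b} (col : Vec Content b) → noPieces col ≡ true → #rooksᶜ col ≡ 0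
  noPieces⇒#rooksᶜ≡0 col h =
    countᶠ-false {p = λ ρ → isRook (lookup col ρ)} λ ρ → cong isRook (isNone⇒≡none (allᶠ⁻ h ρ))

  noPieces⇒#filesᶜ≡0 : ∀ {b} (col : Vec Content b) → noPieces col ≡ true → #filesᶜ col ≡ 0
  noPieces⇒#filesᶜ≡0 col h =
    countᶠ-false {p = λ ρ → isFile (lookup col ρ)} λ ρ → cong isFile (isNone⇒≡none (allᶠ⁻ h ρ))

  columnOK⁺ : ∀ {b} (col : Vec Content b) free → AtMostOnePiece col → PiecesIn free col → columnOK col free ≡ true
  columnOK⁺ []           free one inFree = refl
  columnOK⁺ (none ∷ col) free one inFree =
    columnOK⁺ col (free ∘ suc) (λ ρ≢ρ' → one (ρ≢ρ' ∘ suc-injective)) (inFree ∘ suc)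
  columnOK⁺ (rook ∷ col) free one inFree = ∧-intro (inFree zero) (allᶠ⁺ λ ρ → one {zero} {suc ρ} λ ())
  columnOK⁺ (file ∷ col) free one inFree = ∧-intro (inFree zero) (allᶠ⁺ λ ρ → one {zero} {suc ρ} λ ())

  pieceAtBottom : ∀ {b x} {col : Vec Content b} {free} → free zero ≡ true × noPieces col ≡ true →
    AtMostOnePiece (x ∷ col) × PiecesIn free (x ∷ col)
  pieceAtBottom {x = x} {col} {free} (free₀ , np) = one , inFree
    where
    one : AtMostOnePiece (x ∷ col)
    one {zero}  {zero}   ρ≢ρ' = ⊥-elim (ρ≢ρ' refl)
    one {zero}  {suc ρ'} _    = ∨-introʳ (isNone x) (allᶠ⁻ np ρ')
    one {suc ρ} {ρ'}     _    = ∨-introˡ _ (allᶠ⁻ np ρ)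
    inFree : PiecesIn free (x ∷ col)
    inFree zero    = ∨-introʳ (isNone x) free₀
    inFree (suc ρ) = ∨-introˡ _ (allᶠ⁻ np ρ)

  columnOK⁻ : ∀ {b} (col : Vec Content b) free → columnOK col free ≡ true → AtMostOnePiece col × PiecesIn free col
  columnOK⁻ []           free ok = (λ { {()} }) , λ ()
  columnOK⁻ (none ∷ col) free ok = one , inFree
    where
    one : AtMostOnePiece (none ∷ col)
    one {zero}  {ρ'}    _     = refl
    one {suc ρ} {zero}  _     = ∨-zeroʳ _
    one {suc ρ} {suc ρ'} ρ≢ρ' = proj₁ (columnOK⁻ col (free ∘ suc) ok) (ρ≢ρ' ∘ cong suc)
    inFree : PiecesIn free (none ∷ col)
    inFree zero    = refl
    inFree (suc ρ) = proj₂ (columnOK⁻ col (free ∘ suc) ok) ρ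
  columnOK⁻ (rook ∷ col) free ok = pieceAtBottom (∧-elim ok)
  columnOK⁻ (file ∷ col) free ok = pieceAtBottom (∧-elim ok)

  noPieces⇒#pieces≡0 : ∀ {b} (col : Vec Content b) → noPieces col ≡ true → #rooksᶜ col + #filesᶜ col ≡ 0
  noPieces⇒#pieces≡0 col np = cong₂ _+_ (noPieces⇒#rooksᶜ≡0 col np) (noPieces⇒#filesᶜ≡0 col np)

  #rooksᶜ+#filesᶜ≤1 : ∀ {b} (col : Vec Content b) free → columnOK col free ≡ true → #rooksᶜ col + #filesᶜ col ≤ 1
  #rooksᶜ+#filesᶜ≤1 []           free ok = z≤n
  #rooksᶜ+#filesᶜ≤1 (none ∷ col) free ok = #rooksᶜ+#filesᶜ≤1 col (free ∘ suc) ok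
  #rooksᶜ+#filesᶜ≤1 (rook ∷ col) free ok = ℕ.≤-reflexive (cong suc (noPieces⇒#pieces≡0 col (proj₂ (∧-elim ok))))
  #rooksᶜ+#filesᶜ≤1 (file ∷ col) free ok =
    ℕ.≤-reflexive (trans (ℕ.+-suc (#rooksᶜ col) _) (cong suc (noPieces⇒#pieces≡0 col (proj₂ (∧-elim ok)))))

  noPieces⇒#stillFree≡#free : ∀ {b} (col : Vec Content b) free → noPieces col ≡ true →
    countᶠ (λ ρ → not (isRook (lookup col ρ)) ∧ free ρ) ≡ countᶠ free
  noPieces⇒#stillFree≡#free col free np =
    countᶠ-cong λ ρ → cong (λ x → not (isRook x) ∧ free ρ) (isNone⇒≡none (allᶠ⁻ np ρ))

  #rooksᶜ+#stillFree≡#free : ∀ {b} (col : Vec Content b) free → columnOK col free ≡ true →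
    #rooksᶜ col + countᶠ (λ ρ → not (isRook (lookup col ρ)) ∧ free ρ) ≡ countᶠ free
  #rooksᶜ+#stillFree≡#free []           free ok = refl
  #rooksᶜ+#stillFree≡#free (none ∷ col) free ok with free zero
  ... | true  = trans (ℕ.+-suc (#rooksᶜ col) _) (cong suc (#rooksᶜ+#stillFree≡#free col (free ∘ suc) ok))
  ... | false = #rooksᶜ+#stillFree≡#free col (free ∘ suc) ok
  #rooksᶜ+#stillFree≡#free (rook ∷ col) free ok with free zero | ok
  ... | true | np = cong suc (cong₂ _+_ (noPieces⇒#rooksᶜ≡0 col np) (noPieces⇒#stillFree≡#free col (free ∘ suc) np))
  #rooksᶜ+#stillFree≡#free (file ∷ col) free ok with free zero | ok
  ... | true | np = cong₂ _+_ (noPieces⇒#rooksᶜ≡0 col np) (cong suc (noPieces⇒#stillFree≡#free col (free ∘ suc) np))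

  -- at (col ∷ φ) and col ∷ᴬ at φ compute to the same entries, so their statistics agree by refl.
  _∷ᴬ_ : ∀ {a b} → Vec Content b → Array a b → Array (suc a) b
  (col ∷ᴬ A) zero    ρ = lookup col ρ
  (col ∷ᴬ A) (suc c) ρ = A c ρ

  record FullColumnAdded {a b} (g : Board (suc a) b) (f : Board a b) : Set where
    constructor fullColumnAdded
    field
      newColumn  : ∀ ρ → g zero ρ ≡ true
      oldColumns : ∀ c ρ → g (suc c) ρ ≡ f c ρ

  emptyInFirstColumn : ∀ {a b} → Vec Content b → Array a b → Fin b → Bool
  emptyInFirstColumn col A ρ = isNone (lookup col ρ) ∧ not (cancelledᴬ (col ∷ᴬ A) zero ρ)

  #empty-firstColumn : ∀ {a b} (col : Vec Content b) (A : Array a b) →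
    countᶠ (emptyInFirstColumn col A) ≡ #emptyᶜ col (rookFree A)
  #empty-firstColumn []           A = refl
  #empty-firstColumn {b = suc b} (none ∷ col) A =
    cong₂ (λ t n → if t then suc n else n) bottomFree (#empty-firstColumn col (λ c ρ → A c (suc ρ)))
    where
    bottomFree : not (anyᶠ {b} (λ _ → false) ∨ anyᶠ (λ c → isRook (A c zero)) ∨ anyᶠ {b} (λ _ → false))
               ≡ rookFree A zero
    bottomFree rewrite anyᶠ-false b | ∨-identityʳ (anyᶠ (λ c → isRook (A c zero))) =
      not-anyᶠ (λ c → isRook (A c zero))
  #empty-firstColumn (rook ∷ col) A = countᶠ-false {p = emptyInFirstColumn (rook ∷ col) A} λ
    { zero    → refl
    ; (suc ρ) → ∧-not-∧-true (isNone (lookup col ρ)) refl }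
  #empty-firstColumn (file ∷ col) A = countᶠ-false {p = emptyInFirstColumn (file ∷ col) A} λ
    { zero    → refl
    ; (suc ρ) → ∧-not-∧-true (isNone (lookup col ρ))
                  (∨-introʳ (anyᶠ λ ρ' → ρ' <ᶠ ρ ∧ isRook (lookup col ρ'))
                    (∨-introʳ (anyᶠ λ c → isRook (A c (suc ρ))) refl)) }

  module ColumnStep {a b : ℕ} (col : Vec Content b) (A : Array a b) where

    supported-∷ᴬ : ∀ {g f} → FullColumnAdded g f → supportedᴬ g (col ∷ᴬ A) ≡ supportedᴬ f A
    supported-∷ᴬ (fullColumnAdded new old) = cong₂ _∧_
      (allᶠ⁺ λ ρ → cong (_∨ isNone (lookup col ρ)) (new ρ))
      (allᶠ-cong λ c → allᶠ-cong λ ρ → cong (_∨ isNone (A c ρ)) (old c ρ))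

    #empty-∷ᴬ : ∀ {g f} → FullColumnAdded g f → #emptyᴬ g (col ∷ᴬ A) ≡ #emptyᶜ col (rookFree A) + #emptyᴬ f A
    #empty-∷ᴬ (fullColumnAdded new old) = cong₂ _+_
      (trans (countᶠ-cong λ ρ → cong (_∧ (isNone (lookup col ρ) ∧ not (cancelledᴬ (col ∷ᴬ A) zero ρ))) (new ρ))
             (#empty-firstColumn col A))
      (sumᶠ-cong λ c → countᶠ-cong λ ρ → cong (_∧ (isNone (A c ρ) ∧ not (cancelledᴬ A c ρ))) (old c ρ))

    nonAttacking-∷ᴬ : nonAttackingᴬ (col ∷ᴬ A) ≡ nonAttackingᴬ A ∧ columnOK col (rookFree A)
    nonAttacking-∷ᴬ = true⇔true⇒≡ split join
      where
      split : nonAttackingᴬ (col ∷ᴬ A) ≡ true → nonAttackingᴬ A ∧ columnOK col (rookFree A) ≡ true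
      split na = ∧-intro (nonAttackingᴬ⁺ {A = A} λ c ρ c' ρ' → ok (suc c) ρ (suc c') ρ')
                         (columnOK⁺ col (rookFree A) one inFree)
        where
        ok = nonAttackingᴬ⁻ {A = col ∷ᴬ A} na
        one : AtMostOnePiece col
        one {ρ} {ρ'} ρ≢ρ' = compatible-sameColumn⁻ (lookup col ρ) (lookup col ρ')
          (==-≢ ρ≢ρ') (==-≢ (ρ≢ρ' ∘ sym)) (ok zero ρ zero ρ') (ok zero ρ' zero ρ)
        inFree : PiecesIn (rookFree A) col
        inFree ρ = ∨-allᶠ⁺ (isNone (lookup col ρ)) λ c →
          compatible-leftInRow⁻ (lookup col ρ) (A c ρ) (==-refl ρ) (ok zero ρ (suc c) ρ)

      join : nonAttackingᴬ A ∧ columnOK col (rookFree A) ≡ true → nonAttackingᴬ (col ∷ᴬ A) ≡ true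
      join h = nonAttackingᴬ⁺ {A = col ∷ᴬ A} ok
        where
        okA = nonAttackingᴬ⁻ {A = A} (proj₁ (∧-elim h))
        one = proj₁ (columnOK⁻ col (rookFree A) (proj₂ (∧-elim h)))
        inFree : ∀ ρ c → isNone (lookup col ρ) ∨ not (isRook (A c ρ)) ≡ true
        inFree ρ = ∨-allᶠ⁻ (isNone (lookup col ρ)) (proj₂ (columnOK⁻ col (rookFree A) (proj₂ (∧-elim h))) ρ)
        ok : ∀ c ρ c' ρ' → compatibleAt (col ∷ᴬ A) c ρ c' ρ' ≡ true
        ok zero ρ zero ρ' with ρ ≟ ρ'
        ... | yes refl = compatible-sameCell (lookup col ρ) (lookup col ρ) false (==-refl ρ)
        ... | no ρ≢ρ'  = compatible-sameColumn⁺ (lookup col ρ) (lookup col ρ') false (==-≢ ρ≢ρ') (one ρ≢ρ')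
        ok zero ρ (suc c') ρ' with ρ ≟ ρ'
        ... | yes refl = compatible-leftInRow⁺ (lookup col ρ) (A c' ρ) (==-refl ρ) (inFree ρ c')
        ... | no ρ≢ρ'  = compatible-otherLines (lookup col ρ) (A c' ρ') true (==-≢ ρ≢ρ')
        ok (suc c) ρ zero ρ' with ρ ≟ ρ'
        ... | yes refl = compatible-rightInRow⁺ (A c ρ) (lookup col ρ) (==-refl ρ) (inFree ρ c)
        ... | no ρ≢ρ'  = compatible-otherLines (A c ρ) (lookup col ρ') false (==-≢ ρ≢ρ')
        ok (suc c) ρ (suc c') ρ' = okA c ρ c' ρ'

    admissible-∷ᴬ : ∀ {g f} → FullColumnAdded g f → admissible g (col ∷ᴬ A) ≡ admissible f A ∧ columnOK col (rookFree A)
    admissible-∷ᴬ {f = f} g≈f = trans (cong₂ _∧_ (supported-∷ᴬ g≈f) nonAttacking-∷ᴬ)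
                                      (sym (∧-assoc (supportedᴬ f A) (nonAttackingᴬ A) _))

  raise : ∀ {a b} → Array a b → Array a (suc b)
  raise A c zero    = none
  raise A c (suc ρ) = A c ρ

  record EmptyRowAdded {a b} (g : Board a (suc b)) (f : Board a b) : Set where
    constructor emptyRowAdded
    field
      newRow  : ∀ c → g c zero ≡ false
      oldRows : ∀ c ρ → g c (suc ρ) ≡ f c ρ

  module RowStep {a b : ℕ} {g : Board a (suc b)} {f : Board a b} (g≈f : EmptyRowAdded g f) (A : Array a b) where

    open EmptyRowAdded g≈f

    supported-raise : supportedᴬ g (raise A) ≡ supportedᴬ f A
    supported-raise = allᶠ-cong λ c → cong₂ _∧_ (∨-zeroʳ (g c zero))
      (allᶠ-cong λ ρ → cong (_∨ isNone (A c ρ)) (oldRows c ρ))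

    nonAttacking-raise : nonAttackingᴬ (raise A) ≡ nonAttackingᴬ A
    nonAttacking-raise = true⇔true⇒≡
      (λ na → nonAttackingᴬ⁺ {A = A} λ c ρ c' ρ' → nonAttackingᴬ⁻ {A = raise A} na c (suc ρ) c' (suc ρ'))
      (λ na → nonAttackingᴬ⁺ {A = raise A} (ok (nonAttackingᴬ⁻ {A = A} na)))
      where
      ok : (∀ c ρ c' ρ' → compatibleAt A c ρ c' ρ' ≡ true) → ∀ c ρ c' ρ' → compatibleAt (raise A) c ρ c' ρ' ≡ true
      ok okA c zero    c' ρ'      = compatible-noneˡ (raise A c' ρ') (c == c') (zero == ρ') (c <ᶠ c')
      ok okA c (suc ρ) c' zero    = compatible-noneʳ (A c ρ) (c == c') (suc ρ == zero) (c <ᶠ c')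
      ok okA c (suc ρ) c' (suc ρ') = okA c ρ c' ρ'

    #empty-raise : #emptyᴬ g (raise A) ≡ #emptyᴬ f A
    #empty-raise = sumᶠ-cong λ c →
      trans (countᶠ-falseHead {p = λ ρ → g c ρ ∧ isNone (raise A c ρ) ∧ not (cancelledᴬ (raise A) c ρ)}
                (cong (_∧ not (cancelledᴬ (raise A) c zero)) (newRow c)))
            (countᶠ-cong λ ρ → cong (_∧ (isNone (A c ρ) ∧ not (cancelledᴬ A c ρ))) (oldRows c ρ))

    admissible-raise : admissible g (raise A) ≡ admissible f A
    admissible-raise = cong₂ _∧_ supported-raise nonAttacking-raise

  module _ {a b : ℕ} {g : Board a (suc b)} {f : Board a b} (g≈f : EmptyRowAdded g f) (A : Array a (suc b)) where

    bottomRowEmpty : supportedᴬ g A ≡ true → ∀ c → isNone (A c zero) ≡ true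
    bottomRowEmpty sp c = subst (λ t → t ∨ isNone (A c zero) ≡ true) (EmptyRowAdded.newRow g≈f c)
      (allᶠ⁻ {p = λ ρ → g c ρ ∨ isNone (A c ρ)} (allᶠ⁻ sp c) zero)

    pieceInBottomRow⇒¬supported : ∀ c → isNone (A c zero) ≡ false → supportedᴬ g A ≡ false
    pieceInBottomRow⇒¬supported c notNone with supportedᴬ g A in sp
    ... | false = refl
    ... | true  with () ← trans (sym (bottomRowEmpty sp c)) notNone

  module _ {a b : ℕ} {A A' : Array a b} (A≗A' : ∀ c ρ → A c ρ ≡ A' c ρ) where

    supported-cong : ∀ inB → supportedᴬ inB A ≡ supportedᴬ inB A'
    supported-cong inB = allᶠ-cong λ c → allᶠ-cong λ ρ → cong (λ x → inB c ρ ∨ isNone x) (A≗A' c ρ)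

    nonAttacking-cong : nonAttackingᴬ A ≡ nonAttackingᴬ A'
    nonAttacking-cong = allᶠ-cong λ c → allᶠ-cong λ ρ → allᶠ-cong λ c' → allᶠ-cong λ ρ' →
      cong₂ (λ x y → compatible x y (c == c') (ρ == ρ') (c <ᶠ c')) (A≗A' c ρ) (A≗A' c' ρ')

    #rooks-cong : #rooksᴬ A ≡ #rooksᴬ A'
    #rooks-cong = sumᶠ-cong λ c → countᶠ-cong λ ρ → cong isRook (A≗A' c ρ)

    #files-cong : #filesᴬ A ≡ #filesᴬ A'
    #files-cong = sumᶠ-cong λ c → countᶠ-cong λ ρ → cong isFile (A≗A' c ρ)

    cancelled-cong : ∀ c ρ → cancelledᴬ A c ρ ≡ cancelledᴬ A' c ρ
    cancelled-cong c ρ = cong₂ _∧_ (cong isNone (A≗A' c ρ)) (cong₂ _∨_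
      (anyᶠ-cong λ ρ' → cong (λ x → ρ' <ᶠ ρ ∧ isRook x) (A≗A' c ρ'))
      (cong₂ _∨_ (anyᶠ-cong λ c' → cong (λ x → c <ᶠ c' ∧ isRook x) (A≗A' c' ρ))
                 (anyᶠ-cong λ ρ' → cong (λ x → ρ' <ᶠ ρ ∧ isFile x) (A≗A' c ρ'))))

    #empty-cong : ∀ inB → #emptyᴬ inB A ≡ #emptyᴬ inB A'
    #empty-cong inB = sumᶠ-cong λ c → countᶠ-cong λ ρ →
      cong₂ (λ x y → inB c ρ ∧ isNone x ∧ not y) (A≗A' c ρ) (cancelled-cong c ρ)

    admissible-cong : ∀ inB → admissible inB A ≡ admissible inB A'
    admissible-cong inB = cong₂ _∧_ (supported-cong inB) nonAttacking-cong

  shift : ∀ {a b} → Placement a b → Placement a (suc b)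
  shift []          = []
  shift (col ∷ φ) = (none ∷ col) ∷ shift φ

  at-shift : ∀ {a b} (φ : Placement a b) c ρ → at (shift φ) c ρ ≡ raise (at φ) c ρ
  at-shift (col ∷ φ) zero    zero    = refl
  at-shift (col ∷ φ) zero    (suc ρ) = refl
  at-shift (col ∷ φ) (suc c) zero    = at-shift φ c zero
  at-shift (col ∷ φ) (suc c) (suc ρ) = at-shift φ c (suc ρ)

  #rooks+#rookFree≡rows : ∀ {a b} (φ : Placement a b) → nonAttackingᴬ (at φ) ≡ true →
    #rooksᴬ (at φ) + countᶠ (rookFree (at φ)) ≡ b
  #rooks+#rookFree≡rows {b = b} []      _  = countᶠ-true b
  #rooks+#rookFree≡rows (col ∷ φ) na = begin
    (#rooksᶜ col + R) + countᶠ freeLeft ≡⟨ cong (_+ countᶠ freeLeft) (ℕ.+-comm (#rooksᶜ col) R) ⟩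
    (R + #rooksᶜ col) + countᶠ freeLeft ≡⟨ ℕ.+-assoc R (#rooksᶜ col) _ ⟩
    R + (#rooksᶜ col + countᶠ freeLeft) ≡⟨ cong (R +_) (#rooksᶜ+#stillFree≡#free col (rookFree (at φ)) (proj₂ parts)) ⟩
    R + countᶠ (rookFree (at φ))        ≡⟨ #rooks+#rookFree≡rows φ (proj₁ parts) ⟩
    _ ∎
    where
    open ≡-Reasoning
    R = #rooksᴬ (at φ)
    freeLeft = λ ρ → not (isRook (lookup col ρ)) ∧ rookFree (at φ) ρ
    parts = ∧-elim (trans (sym (ColumnStep.nonAttacking-∷ᴬ col (at φ))) na)

  #rooks+#files≤columns : ∀ {a b} (φ : Placement a b) → nonAttackingᴬ (at φ) ≡ true →
    #rooksᴬ (at φ) + #filesᴬ (at φ) ≤ a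
  #rooks+#files≤columns []        _  = z≤n
  #rooks+#files≤columns (col ∷ φ) na = begin
    (#rooksᶜ col + #rooksᴬ (at φ)) + (#filesᶜ col + #filesᴬ (at φ))
      ≡⟨ interchange (#rooksᶜ col) (#rooksᴬ (at φ)) (#filesᶜ col) (#filesᴬ (at φ)) ⟩
    (#rooksᶜ col + #filesᶜ col) + (#rooksᴬ (at φ) + #filesᴬ (at φ))
      ≤⟨ ℕ.+-mono-≤ (#rooksᶜ+#filesᶜ≤1 col (rookFree (at φ)) (proj₂ parts)) (#rooks+#files≤columns φ (proj₁ parts)) ⟩
    suc _ ∎
    where
    open ℕ.≤-Reasoning
    parts = ∧-elim (trans (sym (ColumnStep.nonAttacking-∷ᴬ col (at φ))) na)

module Words where

  open import Data.Bool using (Bool; true; false; if_then_else_)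
  open import Data.Nat using (zero; suc; _+_; _≤_; _<ᵇ_)
  import Data.Nat.Properties as ℕ
  open import Data.Fin using (zero; suc)
  open import Data.List using (List; []; _∷_; _++_; length; replicate; lookup)
  open import Data.Vec using ([]; _∷_)
  open import Relation.Binary.PropositionalEquality
  open BooleanFolds
  open Placements

  -- boardFrom 0 w is inBoard w; the offset i lets the induction run over suffixes of a word.
  boardFrom : (i : ℕ) (w : List Letter) → Board (length (positionsFrom i isX w)) (length (positionsFrom i isY w))
  boardFrom i w c ρ = lookup (positionsFrom i isX w) c <ᵇ lookup (positionsFrom i isY w) ρ

  positionsFrom-≥ : ∀ i p w k → i ≤ lookup (positionsFrom i p w) k
  positionsFrom-≥ i p (l ∷ w) k with p l
  positionsFrom-≥ i p (l ∷ w) zero    | true  = ℕ.≤-refl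
  positionsFrom-≥ i p (l ∷ w) (suc k) | true  = ℕ.m+n≤o⇒n≤o 1 (positionsFrom-≥ (suc i) p w k)
  positionsFrom-≥ i p (l ∷ w) k       | false = ℕ.m+n≤o⇒n≤o 1 (positionsFrom-≥ (suc i) p w k)

  boardFrom-𝕏 : ∀ i w → FullColumnAdded (boardFrom i (𝕏 ∷ w)) (boardFrom (suc i) w)
  boardFrom-𝕏 i w = fullColumnAdded (λ ρ → <⇒<ᵇ≡true (positionsFrom-≥ (suc i) isY w ρ)) λ c ρ → refl

  boardFrom-𝕐 : ∀ i w → EmptyRowAdded (boardFrom i (𝕐 ∷ w)) (boardFrom (suc i) w)
  boardFrom-𝕐 i w = emptyRowAdded (λ c → ≤⇒<ᵇ≡false (ℕ.<⇒≤ (positionsFrom-≥ (suc i) isX w c))) λ c ρ → refl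

  length-positionsFrom : ∀ i p w → length (positionsFrom i p w) ≡ countB p w
  length-positionsFrom i p []      = refl
  length-positionsFrom i p (l ∷ w) with p l
  ... | true  = cong suc (length-positionsFrom (suc i) p w)
  ... | false = length-positionsFrom (suc i) p w

  countB-replicate : ∀ (p : Letter → Bool) l n → countB p (replicate n l) ≡ (if p l then n else 0)
  countB-replicate p l zero    with p l
  ... | true  = refl
  ... | false = refl
  countB-replicate p l (suc n) with p l | countB-replicate p l n
  ... | true  | eq = cong suc eq
  ... | false | eq = eq

  #X-blockWord : ∀ {r} (ns ms : Vec ℕ r) → #X (blockWord ns ms) ≡ sum ms
  #X-blockWord ns ms = trans (length-positionsFrom 0 isX (blockWord ns ms)) (countX ns ms)
    where
    countX : ∀ {r} (ns ms : Vec ℕ r) → countB isX (blockWord ns ms) ≡ sum ms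
    countX []       []       = refl
    countX (n ∷ ns) (m ∷ ms) = begin
      countB isX (blockWord ns ms ++ (replicate n 𝕐 ++ replicate m 𝕏))
        ≡⟨ countB-++ isX (blockWord ns ms) _ ⟩
      countB isX (blockWord ns ms) + countB isX (replicate n 𝕐 ++ replicate m 𝕏)
        ≡⟨ cong₂ _+_ (countX ns ms) (trans (countB-++ isX (replicate n 𝕐) _)
                                           (cong₂ _+_ (countB-replicate isX 𝕐 n) (countB-replicate isX 𝕏 m))) ⟩
      sum ms + m ≡⟨ ℕ.+-comm (sum ms) m ⟩
      m + sum ms ∎
      where open ≡-Reasoning

  #Y-blockWord : ∀ {r} (ns ms : Vec ℕ r) → #Y (blockWord ns ms) ≡ sum ns
  #Y-blockWord ns ms = trans (length-positionsFrom 0 isY (blockWord ns ms)) (countY ns ms)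
    where
    countY : ∀ {r} (ns ms : Vec ℕ r) → countB isY (blockWord ns ms) ≡ sum ns
    countY []       []       = refl
    countY (n ∷ ns) (m ∷ ms) = begin
      countB isY (blockWord ns ms ++ (replicate n 𝕐 ++ replicate m 𝕏))
        ≡⟨ countB-++ isY (blockWord ns ms) _ ⟩
      countB isY (blockWord ns ms) + countB isY (replicate n 𝕐 ++ replicate m 𝕏)
        ≡⟨ cong₂ _+_ (countY ns ms) (trans (countB-++ isY (replicate n 𝕐) _)
                                           (cong₂ _+_ (countB-replicate isY 𝕐 n) (countB-replicate isY 𝕏 m))) ⟩
      sum ns + (n + 0) ≡⟨ trans (cong (sum ns +_) (ℕ.+-identityʳ n)) (ℕ.+-comm (sum ns) n) ⟩
      n + sum ns ∎
      where open ≡-Reasoning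

module RingSums {c ℓ} (R : Ring c ℓ) where

  open import Data.Bool using (Bool; true; false; if_then_else_; _∧_)
  open import Data.Bool.Properties using (if-∧)
  open import Data.Nat using (zero; suc; _≤_; z≤n; s≤s; _≡ᵇ_) renaming (_+_ to _+ℕ_)
  import Data.Nat.Properties as ℕ
  open import Data.List using (List; []; _∷_; _++_; map; concatMap)
  import Relation.Binary.PropositionalEquality as ≡
  open import Relation.Nullary using (yes; no)

  open Ring R hiding (zero)
  open RingDefs R
  open import Relation.Binary.Reasoning.Setoid setoid
  open import Algebra.Properties.CommutativeSemigroup +-commutativeSemigroup using (interchange)
  open BooleanFolds using (≡ᵇ-refl; ≡ᵇ-≢)

  ∑ : ∀ {A : Set} → (A → Carrier) → List A → Carrier
  ∑ h xs = sumᴿ (map h xs)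

  module _ {A : Set} where

    ∑-cong : ∀ {h h' : A → Carrier} xs → (∀ x → h x ≈ h' x) → ∑ h xs ≈ ∑ h' xs
    ∑-cong []       h≈h' = refl
    ∑-cong (x ∷ xs) h≈h' = +-cong (h≈h' x) (∑-cong xs h≈h')

    ∑-zero : ∀ {h : A → Carrier} xs → (∀ x → h x ≈ 0#) → ∑ h xs ≈ 0#
    ∑-zero []       h≈0 = refl
    ∑-zero (x ∷ xs) h≈0 = trans (+-cong (h≈0 x) (∑-zero xs h≈0)) (+-identityˡ 0#)

    ∑-++ : ∀ (h : A → Carrier) xs ys → ∑ h (xs ++ ys) ≈ ∑ h xs + ∑ h ys
    ∑-++ h []       ys = sym (+-identityˡ _)
    ∑-++ h (x ∷ xs) ys = trans (+-congˡ (∑-++ h xs ys)) (sym (+-assoc _ _ _))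

    ∑-+ : ∀ (h h' : A → Carrier) xs → ∑ (λ x → h x + h' x) xs ≈ ∑ h xs + ∑ h' xs
    ∑-+ h h' []       = sym (+-identityˡ 0#)
    ∑-+ h h' (x ∷ xs) = trans (+-congˡ (∑-+ h h' xs)) (interchange _ _ _ _)

    ∑-distribˡ : ∀ z (h : A → Carrier) xs → z * ∑ h xs ≈ ∑ (λ x → z * h x) xs
    ∑-distribˡ z h []       = zeroʳ z
    ∑-distribˡ z h (x ∷ xs) = trans (distribˡ z _ _) (+-congˡ (∑-distribˡ z h xs))

    ∑-distribʳ : ∀ z (h : A → Carrier) xs → ∑ h xs * z ≈ ∑ (λ x → h x * z) xs
    ∑-distribʳ z h []       = zeroˡ z
    ∑-distribʳ z h (x ∷ xs) = trans (distribʳ z _ _) (+-congˡ (∑-distribʳ z h xs))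

    ∑-filterB : ∀ (h : A → Carrier) (p : A → Bool) xs → ∑ h (filterB p xs) ≈ ∑ (λ x → if p x then h x else 0#) xs
    ∑-filterB h p []       = refl
    ∑-filterB h p (x ∷ xs) with p x
    ... | true  = +-congˡ (∑-filterB h p xs)
    ... | false = trans (∑-filterB h p xs) (sym (+-identityˡ _))

  module _ {A B : Set} where

    ∑-map : ∀ (h : B → Carrier) (k : A → B) xs → ∑ h (map k xs) ≈ ∑ (λ x → h (k x)) xs
    ∑-map h k []       = refl
    ∑-map h k (x ∷ xs) = +-congˡ (∑-map h k xs)

    ∑-concatMap : ∀ (h : B → Carrier) (k : A → List B) xs → ∑ h (concatMap k xs) ≈ ∑ (λ x → ∑ h (k x)) xs
    ∑-concatMap h k []       = refl
    ∑-concatMap h k (x ∷ xs) = trans (∑-++ h (k x) (concatMap k xs)) (+-congˡ (∑-concatMap h k xs))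

    ∑-comm : ∀ (h : A → B → Carrier) xs ys → ∑ (λ x → ∑ (h x) ys) xs ≈ ∑ (λ y → ∑ (λ x → h x y) xs) ys
    ∑-comm h []       ys = sym (∑-zero ys λ _ → refl)
    ∑-comm h (x ∷ xs) ys = trans (+-congˡ (∑-comm h xs ys)) (sym (∑-+ (h x) (λ y → ∑ (λ x → h x y) xs) ys))

  Σ≤-cong : ∀ N {h h' : ℕ → Carrier} → (∀ k → h k ≈ h' k) → Σ≤ N h ≈ Σ≤ N h'
  Σ≤-cong zero    h≈h' = h≈h' 0
  Σ≤-cong (suc N) h≈h' = +-cong (Σ≤-cong N h≈h') (h≈h' (suc N))

  Σ≤-∑ : ∀ {A : Set} N (h : ℕ → A → Carrier) xs → Σ≤ N (λ k → ∑ (h k) xs) ≈ ∑ (λ x → Σ≤ N (λ k → h k x)) xs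
  Σ≤-∑ zero    h xs = refl
  Σ≤-∑ (suc N) h xs = trans (+-congʳ (Σ≤-∑ N h xs)) (sym (∑-+ (λ x → Σ≤ N (λ k → h k x)) (h (suc N)) xs))

  Σ≤-zero : ∀ N {h : ℕ → Carrier} → (∀ k → k ≤ N → h k ≈ 0#) → Σ≤ N h ≈ 0#
  Σ≤-zero zero    h≈0 = h≈0 0 z≤n
  Σ≤-zero (suc N) h≈0 = trans (+-cong (Σ≤-zero N λ k k≤N → h≈0 k (ℕ.m≤n⇒m≤1+n k≤N)) (h≈0 (suc N) ℕ.≤-refl))
                              (+-identityˡ 0#)

  Σ≤-if : ∀ N t (h : ℕ → Carrier) → Σ≤ N (λ k → if t then h k else 0#) ≈ (if t then Σ≤ N h else 0#)
  Σ≤-if N true  h = refl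
  Σ≤-if N false h = Σ≤-zero N λ _ _ → refl

  Σ≤-δ : ∀ N r (h : ℕ → Carrier) → r ≤ N → Σ≤ N (λ k → if r ≡ᵇ k then h k else 0#) ≈ h r
  Σ≤-δ zero    .zero h z≤n = refl
  Σ≤-δ (suc N) r     h r≤1+N with r ℕ.≟ suc N
  ... | yes ≡.refl rewrite ≡ᵇ-refl r = trans (+-congʳ (Σ≤-zero N below)) (+-identityˡ _)
    where
    below : ∀ k → k ≤ N → (if suc N ≡ᵇ k then h k else 0#) ≈ 0#
    below k k≤N rewrite ≡ᵇ-≢ {suc N} {k} (λ { ≡.refl → ℕ.<-irrefl ≡.refl (s≤s k≤N) }) = refl
  ... | no r≢1+N rewrite ≡ᵇ-≢ r≢1+N =
    trans (+-identityʳ _) (Σ≤-δ N r h (ℕ.≤-pred (ℕ.≤∧≢⇒< r≤1+N r≢1+N)))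

  Σ≤²-δ : ∀ M (N : ℕ → ℕ) r s (h : ℕ → ℕ → Carrier) → r ≤ M → s ≤ N r →
    Σ≤ M (λ k → Σ≤ (N k) (λ l → if (r ≡ᵇ k) ∧ (s ≡ᵇ l) then h k l else 0#)) ≈ h r s
  Σ≤²-δ M N r s h r≤M s≤Nr = begin
    Σ≤ M (λ k → Σ≤ (N k) (λ l → if (r ≡ᵇ k) ∧ (s ≡ᵇ l) then h k l else 0#))
      ≈⟨ Σ≤-cong M (λ k → trans (Σ≤-cong (N k) λ l → reflexive (if-∧ (r ≡ᵇ k))) (Σ≤-if (N k) (r ≡ᵇ k) _)) ⟩
    Σ≤ M (λ k → if r ≡ᵇ k then Σ≤ (N k) (λ l → if s ≡ᵇ l then h k l else 0#) else 0#)
      ≈⟨ Σ≤-δ M r _ r≤M ⟩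
    Σ≤ (N r) (λ l → if s ≡ᵇ l then h r l else 0#)
      ≈⟨ Σ≤-δ (N r) s (h r) s≤Nr ⟩
    h r s ∎

  Central : Carrier → Set _
  Central z = ∀ w → z * w ≈ w * z

  central-0# : Central 0#
  central-0# w = trans (zeroˡ w) (sym (zeroʳ w))

  central-1# : Central 1#
  central-1# w = trans (*-identityˡ w) (sym (*-identityʳ w))

  central-* : ∀ {z z'} → Central z → Central z' → Central (z * z')
  central-* {z} {z'} cz cz' w = begin
    (z * z') * w ≈⟨ *-assoc z z' w ⟩
    z * (z' * w) ≈⟨ *-congˡ (cz' w) ⟩
    z * (w * z') ≈⟨ sym (*-assoc z w z') ⟩
    (z * w) * z' ≈⟨ *-congʳ (cz w) ⟩
    (w * z) * z' ≈⟨ *-assoc w z z' ⟩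
    w * (z * z') ∎

  central-+ : ∀ {z z'} → Central z → Central z' → Central (z + z')
  central-+ cz cz' w = trans (distribʳ w _ _) (trans (+-cong (cz w) (cz' w)) (sym (distribˡ w _ _)))

  central-^ : ∀ {z} → Central z → ∀ n → Central (z ^ᴿ n)
  central-^ cz zero    = central-1#
  central-^ cz (suc n) = central-* cz (central-^ cz n)

  central-swap : ∀ {z} → Central z → ∀ u w → u * (z * w) ≈ z * (u * w)
  central-swap cz u w = trans (sym (*-assoc _ _ _)) (trans (*-congʳ (sym (cz u))) (*-assoc _ _ _))

  ^ᴿ-+ : ∀ x m n → x ^ᴿ (m +ℕ n) ≈ x ^ᴿ m * x ^ᴿ n
  ^ᴿ-+ x zero    n = sym (*-identityˡ _)
  ^ᴿ-+ x (suc m) n = trans (*-congˡ (^ᴿ-+ x m n)) (sym (*-assoc _ _ _))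

  [_]_ : ℕ → Carrier → Carrier
  [ zero  ] q = 0#
  [ suc n ] q = 1# + q * [ n ] q

  central-[] : ∀ {q} → Central q → ∀ n → Central ([ n ] q)
  central-[] cq zero    = central-0#
  central-[] cq (suc n) = central-+ central-1# (central-* cq (central-[] cq n))

module Expansion {c ℓ} (R : Ring c ℓ) where

  open Ring R hiding (zero)
  open RingSums R

  module _ {μ ν q X Y : Carrier} (μ-central : Central μ) (ν-central : Central ν) (q-central : Central q)
           (X*Y-q*Y*X≈μ+ν*Y : X * Y + - (q * (Y * X)) ≈ μ + ν * Y) where

    open import Function using (_∘_)
    open import Data.Bool using (Bool; true; false; if_then_else_; _∧_)
    open import Data.Nat using (zero; suc; pred; _≤_; _≡ᵇ_) renaming (_+_ to _+ℕ_)
    import Data.Nat.Properties as ℕ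
    open import Data.Fin using (Fin; zero; suc)
    open import Data.List using (List; []; _∷_; map; concatMap)
    open import Data.Vec using ([]; _∷_)
    open import Data.Product using (proj₂)
    import Relation.Binary.PropositionalEquality as ≡
    open RingDefs R
    open BooleanFolds
    open Placements
    open import Relation.Binary.Reasoning.Setoid setoid

    X*Y≈q*Y*X+μ+ν*Y : X * Y ≈ q * (Y * X) + (μ + ν * Y)
    X*Y≈q*Y*X+μ+ν*Y = begin
      X * Y                                   ≈⟨ sym (+-identityʳ _) ⟩
      X * Y + 0#                              ≈⟨ +-congˡ (sym (-‿inverseˡ _)) ⟩
      X * Y + (- (q * (Y * X)) + q * (Y * X)) ≈⟨ sym (+-assoc _ _ _) ⟩
      (X * Y + - (q * (Y * X))) + q * (Y * X) ≈⟨ +-congʳ X*Y-q*Y*X≈μ+ν*Y ⟩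
      (μ + ν * Y) + q * (Y * X)               ≈⟨ +-comm _ _ ⟩
      q * (Y * X) + (μ + ν * Y)               ∎

    -- pred 0 = 0 is harmless: lowerTerms 0 only occurs multiplied by [ 0 ] q = 0#.
    lowerTerms : ℕ → Carrier
    lowerTerms n = μ * Y ^ᴿ pred n + ν * Y ^ᴿ n

    [n]*Y*lowerTerms : ∀ n → [ n ] q * (Y * lowerTerms n) ≈ [ n ] q * lowerTerms (suc n)
    [n]*Y*lowerTerms zero    = trans (zeroˡ _) (sym (zeroˡ _))
    [n]*Y*lowerTerms (suc n) = *-congˡ (begin
      Y * (μ * Y ^ᴿ n + ν * Y ^ᴿ suc n)         ≈⟨ distribˡ Y _ _ ⟩
      Y * (μ * Y ^ᴿ n) + Y * (ν * Y ^ᴿ suc n)   ≈⟨ +-cong (central-swap μ-central Y _) (central-swap ν-central Y _) ⟩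
      μ * Y ^ᴿ suc n + ν * Y ^ᴿ suc (suc n)     ∎)

    q*[n]*s+s≈[1+n]*s : ∀ n s → q * ([ n ] q * s) + s ≈ [ suc n ] q * s
    q*[n]*s+s≈[1+n]*s n s = begin
      q * ([ n ] q * s) + s      ≈⟨ +-comm _ _ ⟩
      s + q * ([ n ] q * s)      ≈⟨ +-cong (sym (*-identityˡ s)) (sym (*-assoc _ _ _)) ⟩
      1# * s + q * [ n ] q * s   ≈⟨ sym (distribʳ s _ _) ⟩
      [ suc n ] q * s            ∎

    X*Y^ᴿ : ∀ n → X * Y ^ᴿ n ≈ q ^ᴿ n * Y ^ᴿ n * X + [ n ] q * lowerTerms n
    X*Y^ᴿ zero = begin
      X * 1#                          ≈⟨ *-identityʳ X ⟩
      X                               ≈⟨ sym (trans (*-congʳ (*-identityˡ 1#)) (*-identityˡ X)) ⟩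
      1# * 1# * X                     ≈⟨ sym (trans (+-congˡ (zeroˡ _)) (+-identityʳ _)) ⟩
      1# * 1# * X + 0# * lowerTerms 0 ∎
    X*Y^ᴿ (suc n) = begin
      X * (Y * Y ^ᴿ n)                                   ≈⟨ sym (*-assoc X Y _) ⟩
      (X * Y) * Y ^ᴿ n                                   ≈⟨ *-congʳ X*Y≈q*Y*X+μ+ν*Y ⟩
      (q * (Y * X) + (μ + ν * Y)) * Y ^ᴿ n               ≈⟨ distribʳ _ _ _ ⟩
      q * (Y * X) * Y ^ᴿ n + (μ + ν * Y) * Y ^ᴿ n        ≈⟨ +-cong moveX (trans (distribʳ _ _ _) (+-congˡ (*-assoc _ _ _))) ⟩
      q * (Y * (X * Y ^ᴿ n)) + lowerTerms (suc n)         ≈⟨ +-congʳ (*-congˡ (*-congˡ (X*Y^ᴿ n))) ⟩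
      q * (Y * (q ^ᴿ n * Y ^ᴿ n * X + [ n ] q * lowerTerms n)) + lowerTerms (suc n)
        ≈⟨ +-congʳ (*-congˡ (distribˡ Y _ _)) ⟩
      q * (Y * (q ^ᴿ n * Y ^ᴿ n * X) + Y * ([ n ] q * lowerTerms n)) + lowerTerms (suc n)
        ≈⟨ +-congʳ (distribˡ q _ _) ⟩
      (q * (Y * (q ^ᴿ n * Y ^ᴿ n * X)) + q * (Y * ([ n ] q * lowerTerms n))) + lowerTerms (suc n)
        ≈⟨ +-assoc _ _ _ ⟩
      q * (Y * (q ^ᴿ n * Y ^ᴿ n * X)) + (q * (Y * ([ n ] q * lowerTerms n)) + lowerTerms (suc n))
        ≈⟨ +-cong leading (trans (+-congʳ (*-congˡ lower)) (q*[n]*s+s≈[1+n]*s n _)) ⟩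
      q ^ᴿ suc n * Y ^ᴿ suc n * X + [ suc n ] q * lowerTerms (suc n) ∎
      where
      moveX : q * (Y * X) * Y ^ᴿ n ≈ q * (Y * (X * Y ^ᴿ n))
      moveX = trans (*-assoc _ _ _) (*-congˡ (*-assoc _ _ _))
      leading : q * (Y * (q ^ᴿ n * Y ^ᴿ n * X)) ≈ q ^ᴿ suc n * Y ^ᴿ suc n * X
      leading = begin
        q * (Y * (q ^ᴿ n * Y ^ᴿ n * X))   ≈⟨ *-congˡ (*-congˡ (*-assoc _ _ _)) ⟩
        q * (Y * (q ^ᴿ n * (Y ^ᴿ n * X))) ≈⟨ *-congˡ (central-swap (central-^ q-central n) Y _) ⟩
        q * (q ^ᴿ n * (Y * (Y ^ᴿ n * X))) ≈⟨ sym (*-assoc _ _ _) ⟩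
        q ^ᴿ suc n * (Y * (Y ^ᴿ n * X))   ≈⟨ *-congˡ (sym (*-assoc _ _ _)) ⟩
        q ^ᴿ suc n * (Y ^ᴿ suc n * X)     ≈⟨ sym (*-assoc _ _ _) ⟩
        q ^ᴿ suc n * Y ^ᴿ suc n * X       ∎
      lower : Y * ([ n ] q * lowerTerms n) ≈ [ n ] q * lowerTerms (suc n)
      lower = trans (central-swap (central-[] q-central n) Y _) ([n]*Y*lowerTerms n)

    X*Y^ᴿ*X^ᴿ : ∀ N M → X * (Y ^ᴿ N * X ^ᴿ M) ≈
      q ^ᴿ N * (Y ^ᴿ N * X ^ᴿ suc M) + [ N ] q * (μ * (Y ^ᴿ pred N * X ^ᴿ M) + ν * (Y ^ᴿ N * X ^ᴿ M))
    X*Y^ᴿ*X^ᴿ N M = begin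
      X * (Y ^ᴿ N * X ^ᴿ M)                                       ≈⟨ sym (*-assoc _ _ _) ⟩
      X * Y ^ᴿ N * X ^ᴿ M                                         ≈⟨ *-congʳ (X*Y^ᴿ N) ⟩
      (q ^ᴿ N * Y ^ᴿ N * X + [ N ] q * lowerTerms N) * X ^ᴿ M      ≈⟨ distribʳ _ _ _ ⟩
      q ^ᴿ N * Y ^ᴿ N * X * X ^ᴿ M + [ N ] q * lowerTerms N * X ^ᴿ M
        ≈⟨ +-cong (trans (*-assoc _ _ _) (*-assoc _ _ _))
                  (trans (*-assoc _ _ _) (*-congˡ (trans (distribʳ _ _ _) (+-cong (*-assoc _ _ _) (*-assoc _ _ _))))) ⟩
      q ^ᴿ N * (Y ^ᴿ N * X ^ᴿ suc M) + [ N ] q * (μ * (Y ^ᴿ pred N * X ^ᴿ M) + ν * (Y ^ᴿ N * X ^ᴿ M)) ∎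

    coefficient : ℕ → ℕ → ℕ → Carrier
    coefficient r l e = μ ^ᴿ r * ν ^ᴿ l * q ^ᴿ e

    central-coefficient : ∀ r l e → Central (coefficient r l e)
    central-coefficient r l e = central-* (central-* (central-^ μ-central r) (central-^ ν-central l)) (central-^ q-central e)

    -- The truncated subtractions are exact for non-attacking placements, by #rooks+#rookFree≡rows
    -- and #rooks+#files≤columns.
    monomial : (r l e b a : ℕ) → Carrier
    monomial r l e b a = coefficient r l e * Y ^ᴿ (b ∸ r) * X ^ᴿ (a ∸ r ∸ l)

    monomial-q^ᴿ : ∀ r l k e b a → monomial r l (k +ℕ e) b a ≈ q ^ᴿ k * monomial r l e b a
    monomial-q^ᴿ r l k e b a = begin
      μ^ν^ * q ^ᴿ (k +ℕ e) * y * x      ≈⟨ *-congʳ (*-congʳ (*-congˡ (^ᴿ-+ q k e))) ⟩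
      μ^ν^ * (q ^ᴿ k * q ^ᴿ e) * y * x  ≈⟨ *-congʳ (*-congʳ (central-swap (central-^ q-central k) μ^ν^ (q ^ᴿ e))) ⟩
      q ^ᴿ k * (μ^ν^ * q ^ᴿ e) * y * x  ≈⟨ trans (*-congʳ (*-assoc _ _ _)) (*-assoc _ _ _) ⟩
      q ^ᴿ k * (μ^ν^ * q ^ᴿ e * y * x)  ∎
      where
      μ^ν^ = μ ^ᴿ r * ν ^ᴿ l
      y = Y ^ᴿ (b ∸ r)
      x = X ^ᴿ (a ∸ r ∸ l)

    rescale : ∀ {k c} z u v → Central c → k ≈ z * c → k * Y ^ᴿ u * X ^ᴿ v ≈ c * (z * (Y ^ᴿ u * X ^ᴿ v))
    rescale z u v cc k≈zc = trans (*-assoc _ _ _) (trans (*-congʳ (trans k≈zc (sym (cc z)))) (*-assoc _ _ _))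

    monomial-suc-rooks : ∀ r l e b a →
      monomial (suc r) l e b (suc a) ≈ coefficient r l e * (μ * (Y ^ᴿ pred (b ∸ r) * X ^ᴿ (a ∸ r ∸ l)))
    monomial-suc-rooks r l e b a = begin
      coefficient (suc r) l e * Y ^ᴿ (b ∸ suc r) * X ^ᴿ (a ∸ r ∸ l)
        ≡⟨ ≡.cong (λ u → coefficient (suc r) l e * Y ^ᴿ u * X ^ᴿ (a ∸ r ∸ l)) (≡.sym (ℕ.pred[m∸n]≡m∸[1+n] b r)) ⟩
      coefficient (suc r) l e * Y ^ᴿ pred (b ∸ r) * X ^ᴿ (a ∸ r ∸ l)
        ≈⟨ rescale μ (pred (b ∸ r)) (a ∸ r ∸ l) (central-coefficient r l e) (trans (*-congʳ (*-assoc _ _ _)) (*-assoc _ _ _)) ⟩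
      coefficient r l e * (μ * (Y ^ᴿ pred (b ∸ r) * X ^ᴿ (a ∸ r ∸ l))) ∎

    monomial-suc-files : ∀ r l e b a → r ≤ a →
      monomial r (suc l) e b (suc a) ≈ coefficient r l e * (ν * (Y ^ᴿ (b ∸ r) * X ^ᴿ (a ∸ r ∸ l)))
    monomial-suc-files r l e b a r≤a = begin
      coefficient r (suc l) e * Y ^ᴿ (b ∸ r) * X ^ᴿ (suc a ∸ r ∸ suc l)
        ≡⟨ ≡.cong (λ u → coefficient r (suc l) e * Y ^ᴿ (b ∸ r) * X ^ᴿ (u ∸ suc l)) (ℕ.+-∸-assoc 1 r≤a) ⟩
      coefficient r (suc l) e * Y ^ᴿ (b ∸ r) * X ^ᴿ (a ∸ r ∸ l)
        ≈⟨ rescale ν (b ∸ r) (a ∸ r ∸ l) (central-coefficient r l e) νFirst ⟩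
      coefficient r l e * (ν * (Y ^ᴿ (b ∸ r) * X ^ᴿ (a ∸ r ∸ l))) ∎
      where
      νFirst : μ ^ᴿ r * (ν * ν ^ᴿ l) * q ^ᴿ e ≈ ν * coefficient r l e
      νFirst = begin
        μ ^ᴿ r * (ν * ν ^ᴿ l) * q ^ᴿ e ≈⟨ *-congʳ (central-swap ν-central _ _) ⟩
        ν * (μ ^ᴿ r * ν ^ᴿ l) * q ^ᴿ e ≈⟨ *-assoc _ _ _ ⟩
        ν * coefficient r l e          ∎

    X*monomial : ∀ r l e b a → r +ℕ l ≤ a →
      X * monomial r l e b a ≈
        q ^ᴿ (b ∸ r) * monomial r l e b (suc a) + [ b ∸ r ] q * (monomial (suc r) l e b (suc a) + monomial r (suc l) e b (suc a))
    X*monomial r l e b a r+l≤a = begin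
      X * monomial r l e b a                    ≈⟨ *-congˡ (*-assoc _ _ _) ⟩
      X * (c₀ * (Y ^ᴿ N * X ^ᴿ M))              ≈⟨ central-swap c₀-central X _ ⟩
      c₀ * (X * (Y ^ᴿ N * X ^ᴿ M))              ≈⟨ *-congˡ (X*Y^ᴿ*X^ᴿ N M) ⟩
      c₀ * (q ^ᴿ N * (Y ^ᴿ N * X ^ᴿ suc M) + [ N ] q * (μ * (Y ^ᴿ pred N * X ^ᴿ M) + ν * (Y ^ᴿ N * X ^ᴿ M)))
        ≈⟨ distribˡ c₀ _ _ ⟩
      c₀ * (q ^ᴿ N * (Y ^ᴿ N * X ^ᴿ suc M)) + c₀ * ([ N ] q * (μ * (Y ^ᴿ pred N * X ^ᴿ M) + ν * (Y ^ᴿ N * X ^ᴿ M)))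
        ≈⟨ +-cong (sym (central-swap c₀-central _ _)) (trans (sym (central-swap c₀-central _ _)) (*-congˡ (distribˡ c₀ _ _))) ⟩
      q ^ᴿ N * (c₀ * (Y ^ᴿ N * X ^ᴿ suc M)) + [ N ] q * (c₀ * (μ * (Y ^ᴿ pred N * X ^ᴿ M)) + c₀ * (ν * (Y ^ᴿ N * X ^ᴿ M)))
        ≈⟨ sym (+-cong (*-congˡ noNewPiece) (*-congˡ (+-cong (monomial-suc-rooks r l e b a) (monomial-suc-files r l e b a r≤a)))) ⟩
      q ^ᴿ N * monomial r l e b (suc a) + [ N ] q * (monomial (suc r) l e b (suc a) + monomial r (suc l) e b (suc a)) ∎
      where
      N = b ∸ r
      M = a ∸ r ∸ l
      c₀ = coefficient r l e
      c₀-central = central-coefficient r l e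
      r≤a = ℕ.m+n≤o⇒m≤o r r+l≤a
      suc-a∸r∸l : suc a ∸ r ∸ l ≡.≡ suc M
      suc-a∸r∸l = ≡.trans (ℕ.∸-+-assoc (suc a) r l) (≡.trans (ℕ.+-∸-assoc 1 r+l≤a) (≡.cong suc (≡.sym (ℕ.∸-+-assoc a r l))))
      noNewPiece : monomial r l e b (suc a) ≈ c₀ * (Y ^ᴿ N * X ^ᴿ suc M)
      noNewPiece = trans (reflexive (≡.cong (λ v → c₀ * Y ^ᴿ N * X ^ᴿ v) suc-a∸r∸l)) (*-assoc _ _ _)

    Y*monomial : ∀ r l e b a → r ≤ b → Y * monomial r l e b a ≈ monomial r l e (suc b) a
    Y*monomial r l e b a r≤b = begin
      Y * (coefficient r l e * Y ^ᴿ (b ∸ r) * X ^ᴿ (a ∸ r ∸ l))   ≈⟨ sym (*-assoc _ _ _) ⟩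
      Y * (coefficient r l e * Y ^ᴿ (b ∸ r)) * X ^ᴿ (a ∸ r ∸ l)   ≈⟨ *-congʳ (central-swap (central-coefficient r l e) Y _) ⟩
      coefficient r l e * Y ^ᴿ suc (b ∸ r) * X ^ᴿ (a ∸ r ∸ l)
        ≡⟨ ≡.cong (λ u → coefficient r l e * Y ^ᴿ u * X ^ᴿ (a ∸ r ∸ l)) (≡.sym (ℕ.+-∸-assoc 1 r≤b)) ⟩
      coefficient r l e * Y ^ᴿ (suc b ∸ r) * X ^ᴿ (a ∸ r ∸ l)     ∎

    contents : List Content
    contents = none ∷ rook ∷ file ∷ []

    columns : (b : ℕ) → List (Vec Content b)
    columns b = allVecs b contents

    ∑-columns-suc : ∀ b (h : Vec Content (suc b) → Carrier) → ∑ h (columns (suc b)) ≈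
      ∑ (λ col → h (none ∷ col)) (columns b) + (∑ (λ col → h (rook ∷ col)) (columns b) + ∑ (λ col → h (file ∷ col)) (columns b))
    ∑-columns-suc b h = begin
      ∑ h (concatMap (λ x → map (x ∷_) (columns b)) contents)   ≈⟨ ∑-concatMap h (λ x → map (x ∷_) (columns b)) contents ⟩
      ∑ (λ x → ∑ h (map (x ∷_) (columns b))) contents
        ≈⟨ +-cong (∑-map h (none ∷_) (columns b))
                  (+-cong (∑-map h (rook ∷_) (columns b)) (trans (+-identityʳ _) (∑-map h (file ∷_) (columns b)))) ⟩
      ∑ (λ col → h (none ∷ col)) (columns b) + (∑ (λ col → h (rook ∷ col)) (columns b) + ∑ (λ col → h (file ∷ col)) (columns b)) ∎

    ∑-placements-suc : ∀ a b (h : Placement (suc a) b → Carrier) →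
      ∑ h (allPlacements (suc a) b) ≈ ∑ (λ col → ∑ (λ φ → h (col ∷ φ)) (allPlacements a b)) (columns b)
    ∑-placements-suc a b h = trans (∑-concatMap h (λ col → map (col ∷_) (allPlacements a b)) (columns b))
                                   (∑-cong (columns b) λ col → ∑-map h (col ∷_) (allPlacements a b))

    ∑-emptyColumn : ∀ b (h : ℕ → ℕ → Carrier) →
      ∑ (λ col → if noPieces col then h (#rooksᶜ col) (#filesᶜ col) else 0#) (columns b) ≈ h 0 0
    ∑-emptyColumn zero    h = +-identityʳ _
    ∑-emptyColumn (suc b) h = begin
      ∑ (λ col → if noPieces col then h (#rooksᶜ col) (#filesᶜ col) else 0#) (columns (suc b))
        ≈⟨ ∑-columns-suc b (λ col → if noPieces col then h (#rooksᶜ col) (#filesᶜ col) else 0#) ⟩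
      ∑ (λ col → if noPieces col then h (#rooksᶜ col) (#filesᶜ col) else 0#) (columns b)
        + (∑ (λ _ → 0#) (columns b) + ∑ (λ _ → 0#) (columns b))
        ≈⟨ +-cong (∑-emptyColumn b h) (trans (+-cong (∑-zero (columns b) λ _ → refl) (∑-zero (columns b) λ _ → refl)) (+-identityʳ 0#)) ⟩
      h 0 0 + 0#  ≈⟨ +-identityʳ _ ⟩
      h 0 0       ∎

    -- The empty column contributes q ^ N, a piece in the (j+1)-th free row from the bottom q ^ j.
    module ColumnSum (H : ℕ → ℕ → Carrier) where

      columnTerm : ∀ {b} → (Fin b → Bool) → Vec Content b → Carrier
      columnTerm free col = if columnOK col free then q ^ᴿ #emptyᶜ col free * H (#rooksᶜ col) (#filesᶜ col) else 0#

      bottomEmpty : ∀ {b} (free : Fin (suc b) → Bool) col →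
        columnTerm free (none ∷ col) ≈ (if free zero then q else 1#) * columnTerm (free ∘ suc) col
      bottomEmpty free col with free zero | columnOK col (free ∘ suc)
      ... | true  | true  = *-assoc _ _ _
      ... | true  | false = sym (zeroʳ q)
      ... | false | true  = sym (*-identityˡ _)
      ... | false | false = sym (zeroʳ 1#)

      ∑-bottomRook : ∀ {b} (free : Fin (suc b) → Bool) →
        ∑ (λ col → columnTerm free (rook ∷ col)) (columns b) ≈ (if free zero then H 1 0 else 0#)
      ∑-bottomRook {b} free with free zero
      ... | true  = trans (∑-emptyColumn b λ i j → 1# * H (suc i) j) (*-identityˡ _)
      ... | false = ∑-zero (columns b) λ _ → refl

      ∑-bottomFile : ∀ {b} (free : Fin (suc b) → Bool) →
        ∑ (λ col → columnTerm free (file ∷ col)) (columns b) ≈ (if free zero then H 0 1 else 0#)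
      ∑-bottomFile {b} free with free zero
      ... | true  = trans (∑-emptyColumn b λ i j → 1# * H i (suc j)) (*-identityˡ _)
      ... | false = ∑-zero (columns b) λ _ → refl

      assemble : ∀ t N {S} → S ≈ q ^ᴿ N * H 0 0 + [ N ] q * (H 1 0 + H 0 1) →
        (if t then q else 1#) * S + ((if t then H 1 0 else 0#) + (if t then H 0 1 else 0#))
          ≈ q ^ᴿ (if t then suc N else N) * H 0 0 + [ if t then suc N else N ] q * (H 1 0 + H 0 1)
      assemble true N {S} S≈ = begin
        q * S + (H 1 0 + H 0 1)                                          ≈⟨ +-congʳ (*-congˡ S≈) ⟩
        q * (q ^ᴿ N * H 0 0 + [ N ] q * (H 1 0 + H 0 1)) + (H 1 0 + H 0 1) ≈⟨ +-congʳ (distribˡ q _ _) ⟩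
        (q * (q ^ᴿ N * H 0 0) + q * ([ N ] q * (H 1 0 + H 0 1))) + (H 1 0 + H 0 1)
          ≈⟨ +-assoc _ _ _ ⟩
        q * (q ^ᴿ N * H 0 0) + (q * ([ N ] q * (H 1 0 + H 0 1)) + (H 1 0 + H 0 1))
          ≈⟨ +-cong (sym (*-assoc _ _ _)) (q*[n]*s+s≈[1+n]*s N _) ⟩
        q ^ᴿ suc N * H 0 0 + [ suc N ] q * (H 1 0 + H 0 1)               ∎
      assemble false N {S} S≈ =
        trans (+-cong (*-identityˡ S) (+-identityʳ 0#)) (trans (+-identityʳ S) S≈)

      columnSum : ∀ {b} (free : Fin b → Bool) →
        ∑ (columnTerm free) (columns b) ≈ q ^ᴿ countᶠ free * H 0 0 + [ countᶠ free ] q * (H 1 0 + H 0 1)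
      columnSum {zero} free = +-congˡ (sym (zeroˡ _))
      columnSum {suc b} free = begin
        ∑ (columnTerm free) (columns (suc b))
          ≈⟨ ∑-columns-suc b (columnTerm free) ⟩
        ∑ (λ col → columnTerm free (none ∷ col)) (columns b)
          + (∑ (λ col → columnTerm free (rook ∷ col)) (columns b) + ∑ (λ col → columnTerm free (file ∷ col)) (columns b))
          ≈⟨ +-cong (trans (∑-cong (columns b) (bottomEmpty free)) (sym (∑-distribˡ _ _ (columns b))))
                    (+-cong (∑-bottomRook free) (∑-bottomFile free)) ⟩
        (if free zero then q else 1#) * ∑ (columnTerm (free ∘ suc)) (columns b)
          + ((if free zero then H 1 0 else 0#) + (if free zero then H 0 1 else 0#))
          ≈⟨ assemble (free zero) (countᶠ (free ∘ suc)) (columnSum (free ∘ suc)) ⟩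
        q ^ᴿ countᶠ free * H 0 0 + [ countᶠ free ] q * (H 1 0 + H 0 1) ∎

    weight : ∀ {a b} → Board a b → Array a b → Carrier
    weight {a} {b} inB A = if admissible inB A then monomial (#rooksᴬ A) (#filesᴬ A) (#emptyᴬ inB A) b a else 0#

    boardSum : (a b : ℕ) → Board a b → Carrier
    boardSum a b inB = ∑ (λ φ → weight inB (at φ)) (allPlacements a b)

    weight-cong : ∀ {a b} (inB : Board a b) {A A' : Array a b} → (∀ c ρ → A c ρ ≡.≡ A' c ρ) → weight inB A ≡.≡ weight inB A'
    weight-cong {a} {b} inB {A} {A'} A≗A' =
      ≡.cong₂ (λ ok m → if ok then m else 0#) (admissible-cong A≗A' inB) monomial-≡
      where
      monomial-≡ : monomial (#rooksᴬ A) (#filesᴬ A) (#emptyᴬ inB A) b a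
                   ≡.≡ monomial (#rooksᴬ A') (#filesᴬ A') (#emptyᴬ inB A') b a
      monomial-≡ rewrite #rooks-cong A≗A' | #files-cong A≗A' | #empty-cong A≗A' inB = ≡.refl

    boardSum-empty : (inB : Board 0 0) → boardSum 0 0 inB ≈ 1#
    boardSum-empty inB =
      trans (+-identityʳ _) (trans (*-identityʳ _) (trans (*-identityʳ _) (trans (*-identityʳ _) (*-identityʳ _))))

    module _ {a b} {g : Board (suc a) b} {f : Board a b} (g≈f : FullColumnAdded g f) where

      ∑-weight-∷ᴬ : (φ : Placement a b) → ∑ (λ col → weight g (col ∷ᴬ at φ)) (columns b) ≈ X * weight f (at φ)
      ∑-weight-∷ᴬ φ = trans (∑-cong (columns b) λ col → reflexive (weight-∷ᴬ col)) (byAdmissibility (admissible f A) ≡.refl)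
        where
        A = at φ
        free = rookFree A
        r = #rooksᴬ A
        l = #filesᴬ A
        e = #emptyᴬ f A
        open ColumnSum (λ i j → monomial (i +ℕ r) (j +ℕ l) e b (suc a))

        extended : Bool → Vec Content b → Carrier
        extended ok col = if ok ∧ columnOK col free
          then monomial (#rooksᶜ col +ℕ r) (#filesᶜ col +ℕ l) (#emptyᶜ col free +ℕ e) b (suc a) else 0#

        weight-∷ᴬ : ∀ col → weight g (col ∷ᴬ A) ≡.≡ extended (admissible f A) col
        weight-∷ᴬ col = ≡.cong₂ (λ ok n → if ok then monomial (#rooksᶜ col +ℕ r) (#filesᶜ col +ℕ l) n b (suc a) else 0#)
          (ColumnStep.admissible-∷ᴬ col A g≈f) (ColumnStep.#empty-∷ᴬ col A g≈f)

        pullEmpty : ∀ col → extended true col ≈ columnTerm free col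
        pullEmpty col with columnOK col free
        ... | true  = monomial-q^ᴿ (#rooksᶜ col +ℕ r) (#filesᶜ col +ℕ l) (#emptyᶜ col free) e b (suc a)
        ... | false = refl

        afterX : ℕ → Carrier
        afterX N = q ^ᴿ N * monomial r l e b (suc a) + [ N ] q * (monomial (suc r) l e b (suc a) + monomial r (suc l) e b (suc a))

        byAdmissibility : ∀ ok → admissible f A ≡.≡ ok → ∑ (extended ok) (columns b) ≈ X * (if ok then monomial r l e b a else 0#)
        byAdmissibility false _   = trans (∑-zero (columns b) λ _ → refl) (sym (zeroʳ X))
        byAdmissibility true  adm = begin
          ∑ (extended true) (columns b)   ≈⟨ ∑-cong (columns b) pullEmpty ⟩
          ∑ (columnTerm free) (columns b) ≈⟨ columnSum free ⟩
          afterX (countᶠ free)            ≡⟨ ≡.cong afterX #free≡b∸r ⟩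
          afterX (b ∸ r)                  ≈⟨ sym (X*monomial r l e b a (#rooks+#files≤columns φ na)) ⟩
          X * monomial r l e b a          ∎
          where
          na = proj₂ (∧-elim adm)
          #free≡b∸r : countᶠ free ≡.≡ b ∸ r
          #free≡b∸r = ≡.trans (≡.sym (ℕ.m+n∸m≡n r (countᶠ free))) (≡.cong (_∸ r) (#rooks+#rookFree≡rows φ na))

      X*boardSum : X * boardSum a b f ≈ boardSum (suc a) b g
      X*boardSum = begin
        X * ∑ (λ φ → weight f (at φ)) (allPlacements a b)                       ≈⟨ ∑-distribˡ X _ (allPlacements a b) ⟩
        ∑ (λ φ → X * weight f (at φ)) (allPlacements a b)                       ≈⟨ sym (∑-cong (allPlacements a b) ∑-weight-∷ᴬ) ⟩
        ∑ (λ φ → ∑ (λ col → weight g (col ∷ᴬ at φ)) (columns b)) (allPlacements a b)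
          ≈⟨ ∑-comm (λ φ col → weight g (col ∷ᴬ at φ)) (allPlacements a b) (columns b) ⟩
        ∑ (λ col → ∑ (λ φ → weight g (at (col ∷ φ))) (allPlacements a b)) (columns b)
          ≈⟨ sym (∑-placements-suc a b (λ ψ → weight g (at ψ))) ⟩
        boardSum (suc a) b g ∎

    ∑-bottomRowEmpty : ∀ a {b} (h : Placement a (suc b) → Carrier) → (∀ ψ c → isNone (at ψ c zero) ≡.≡ false → h ψ ≈ 0#) →
      ∑ h (allPlacements a (suc b)) ≈ ∑ (λ φ → h (shift φ)) (allPlacements a b)
    ∑-bottomRowEmpty zero    h vanish = refl
    ∑-bottomRowEmpty (suc a) {b} h vanish = begin
      ∑ h (allPlacements (suc a) (suc b))                      ≈⟨ ∑-placements-suc a (suc b) h ⟩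
      ∑ (λ col → ∑ (λ ψ → h (col ∷ ψ)) (allPlacements a (suc b))) (columns (suc b))
        ≈⟨ ∑-columns-suc b _ ⟩
      ∑ (λ col → ∑ (λ ψ → h ((none ∷ col) ∷ ψ)) (allPlacements a (suc b))) (columns b)
        + (∑ (λ col → ∑ (λ ψ → h ((rook ∷ col) ∷ ψ)) (allPlacements a (suc b))) (columns b)
        +  ∑ (λ col → ∑ (λ ψ → h ((file ∷ col) ∷ ψ)) (allPlacements a (suc b))) (columns b))
        ≈⟨ +-congˡ (trans (+-cong (occupiedBottom rook ≡.refl) (occupiedBottom file ≡.refl)) (+-identityʳ 0#)) ⟩
      ∑ (λ col → ∑ (λ ψ → h ((none ∷ col) ∷ ψ)) (allPlacements a (suc b))) (columns b) + 0#
        ≈⟨ +-identityʳ _ ⟩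
      ∑ (λ col → ∑ (λ ψ → h ((none ∷ col) ∷ ψ)) (allPlacements a (suc b))) (columns b)
        ≈⟨ ∑-cong (columns b) (λ col → ∑-bottomRowEmpty a (λ ψ → h ((none ∷ col) ∷ ψ)) λ ψ c → vanish _ (suc c)) ⟩
      ∑ (λ col → ∑ (λ φ → h (shift (col ∷ φ))) (allPlacements a b)) (columns b)
        ≈⟨ sym (∑-placements-suc a b (λ φ → h (shift φ))) ⟩
      ∑ (λ φ → h (shift φ)) (allPlacements (suc a) b) ∎
      where
      occupiedBottom : ∀ x → isNone x ≡.≡ false →
        ∑ (λ col → ∑ (λ ψ → h ((x ∷ col) ∷ ψ)) (allPlacements a (suc b))) (columns b) ≈ 0#
      occupiedBottom x notNone = ∑-zero (columns b) λ col → ∑-zero (allPlacements a (suc b)) λ ψ → vanish _ zero notNone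

    module _ {a b} {g : Board a (suc b)} {f : Board a b} (g≈f : EmptyRowAdded g f) where

      Y*weight : (φ : Placement a b) → Y * weight f (at φ) ≈ weight g (raise (at φ))
      Y*weight φ = trans (byAdmissibility (admissible f A) ≡.refl) (reflexive (≡.sym weight-raise))
        where
        A = at φ
        open RowStep g≈f A
        weight-raise : weight g (raise A) ≡.≡
          (if admissible f A then monomial (#rooksᴬ A) (#filesᴬ A) (#emptyᴬ f A) (suc b) a else 0#)
        weight-raise = ≡.cong₂ (λ ok n → if ok then monomial (#rooksᴬ A) (#filesᴬ A) n (suc b) a else 0#)
                               admissible-raise #empty-raise
        byAdmissibility : ∀ ok → admissible f A ≡.≡ ok →
          Y * (if ok then monomial (#rooksᴬ A) (#filesᴬ A) (#emptyᴬ f A) b a else 0#)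
            ≈ (if ok then monomial (#rooksᴬ A) (#filesᴬ A) (#emptyᴬ f A) (suc b) a else 0#)
        byAdmissibility false _   = zeroʳ Y
        byAdmissibility true  adm = Y*monomial (#rooksᴬ A) (#filesᴬ A) (#emptyᴬ f A) b a r≤b
          where
          r≤b = ≡.subst (#rooksᴬ A ≤_) (#rooks+#rookFree≡rows φ (proj₂ (∧-elim adm))) (ℕ.m≤m+n _ _)

      Y*boardSum : Y * boardSum a b f ≈ boardSum a (suc b) g
      Y*boardSum = begin
        Y * ∑ (λ φ → weight f (at φ)) (allPlacements a b)   ≈⟨ ∑-distribˡ Y _ (allPlacements a b) ⟩
        ∑ (λ φ → Y * weight f (at φ)) (allPlacements a b)   ≈⟨ ∑-cong (allPlacements a b) Y*weight ⟩
        ∑ (λ φ → weight g (raise (at φ))) (allPlacements a b)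
          ≈⟨ ∑-cong (allPlacements a b) (λ φ → reflexive (weight-cong g λ c ρ → ≡.sym (at-shift φ c ρ))) ⟩
        ∑ (λ φ → weight g (at (shift φ))) (allPlacements a b) ≈⟨ sym (∑-bottomRowEmpty a (λ ψ → weight g (at ψ)) vanish) ⟩
        boardSum a (suc b) g ∎
        where
        vanish : ∀ ψ c → isNone (at ψ c zero) ≡.≡ false → weight g (at ψ) ≈ 0#
        vanish ψ c notNone rewrite pieceInBottomRow⇒¬supported g≈f (at ψ) c notNone = refl

    evalWord≈boardSum : ∀ w i → evalWord X Y w ≈ boardSum _ _ (Words.boardFrom i w)
    evalWord≈boardSum []      i = sym (boardSum-empty (Words.boardFrom i []))
    evalWord≈boardSum (𝕏 ∷ w) i = trans (*-congˡ (evalWord≈boardSum w (suc i))) (X*boardSum (Words.boardFrom-𝕏 i w))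
    evalWord≈boardSum (𝕐 ∷ w) i = trans (*-congˡ (evalWord≈boardSum w (suc i))) (Y*boardSum (Words.boardFrom-𝕐 i w))

    module _ {a b : ℕ} (inB : Board a b) where
      open MixedPlacements inB

      -- mkl μ ν q w is placementNumber (inBoard w) by definition.
      placementNumber : ℕ → ℕ → Carrier
      placementNumber k l = μ ^ᴿ k * ν ^ᴿ l * ∑ (λ φ → q ^ᴿ #empty φ) (mixed k l)

      selected : ℕ → ℕ → Placement a b → Bool
      selected k l φ = supported φ ∧ nonAttacking φ ∧ (#rooks φ ≡ᵇ k) ∧ (#files φ ≡ᵇ l)

      placementNumber-term : ∀ k l → placementNumber k l * Y ^ᴿ (b ∸ k) * X ^ᴿ (a ∸ k ∸ l) ≈
        ∑ (λ φ → if selected k l φ then monomial k l (#empty φ) b a else 0#) (allPlacements a b)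
      placementNumber-term k l = begin
        μ^ν^ * ∑ qᵉ (mixed k l) * y * x               ≈⟨ *-congʳ (*-congʳ (∑-distribˡ μ^ν^ qᵉ (mixed k l))) ⟩
        ∑ (λ φ → μ^ν^ * qᵉ φ) (mixed k l) * y * x     ≈⟨ *-congʳ (∑-distribʳ y _ (mixed k l)) ⟩
        ∑ (λ φ → μ^ν^ * qᵉ φ * y) (mixed k l) * x     ≈⟨ ∑-distribʳ x _ (mixed k l) ⟩
        ∑ (λ φ → monomial k l (#empty φ) b a) (mixed k l) ≈⟨ ∑-filterB _ (selected k l) (allPlacements a b) ⟩
        ∑ (λ φ → if selected k l φ then monomial k l (#empty φ) b a else 0#) (allPlacements a b) ∎
        where
        μ^ν^ = μ ^ᴿ k * ν ^ᴿ l
        qᵉ = λ φ → q ^ᴿ #empty φ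
        y = Y ^ᴿ (b ∸ k)
        x = X ^ᴿ (a ∸ k ∸ l)

      weight-at : ∀ φ → weight inB (at φ) ≡.≡
        (if supported φ ∧ nonAttacking φ then monomial (#rooks φ) (#files φ) (#empty φ) b a else 0#)
      weight-at φ = ≡.cong₂ (λ ok m → if ok then m else 0#)
        (≡.sym (≡.cong₂ _∧_ (supported-at inB φ) (nonAttacking-at inB φ))) monomial-at
        where
        monomial-at : monomial (#rooksᴬ (at φ)) (#filesᴬ (at φ)) (#emptyᴬ inB (at φ)) b a
                      ≡.≡ monomial (#rooks φ) (#files φ) (#empty φ) b a
        monomial-at rewrite #rooks-at inB φ | #files-at inB φ | #empty-at inB φ = ≡.refl

      Σ≤-selected : ∀ φ → Σ≤ (a ⊓ b) (λ k → Σ≤ (a ∸ k) (λ l → if selected k l φ then monomial k l (#empty φ) b a else 0#))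
                          ≈ weight inB (at φ)
      Σ≤-selected φ = trans (byAdmissibility (supported φ) (nonAttacking φ) ≡.refl) (reflexive (≡.sym (weight-at φ)))
        where
        r = #rooks φ
        l₀ = #files φ
        byAdmissibility : ∀ s n → nonAttacking φ ≡.≡ n →
          Σ≤ (a ⊓ b) (λ k → Σ≤ (a ∸ k) (λ l → if s ∧ n ∧ (r ≡ᵇ k) ∧ (l₀ ≡ᵇ l) then monomial k l (#empty φ) b a else 0#))
            ≈ (if s ∧ n then monomial r l₀ (#empty φ) b a else 0#)
        byAdmissibility false _     _  = Σ≤-zero (a ⊓ b) λ k _ → Σ≤-zero (a ∸ k) λ _ _ → refl
        byAdmissibility true  false _  = Σ≤-zero (a ⊓ b) λ k _ → Σ≤-zero (a ∸ k) λ _ _ → refl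
        byAdmissibility true  true  na = Σ≤²-δ (a ⊓ b) (a ∸_) r l₀ (λ k l → monomial k l (#empty φ) b a)
          (ℕ.⊓-glb (ℕ.m+n≤o⇒m≤o r r+l₀≤a) r≤b) (ℕ.m+n≤o⇒m≤o∸n l₀ (≡.subst (_≤ a) (ℕ.+-comm r l₀) r+l₀≤a))
          where
          naᴬ = ≡.trans (≡.sym (nonAttacking-at inB φ)) na
          r+l₀≤a : r +ℕ l₀ ≤ a
          r+l₀≤a = ≡.subst₂ (λ i j → i +ℕ j ≤ a) (≡.sym (#rooks-at inB φ)) (≡.sym (#files-at inB φ))
                              (#rooks+#files≤columns φ naᴬ)
          r≤b : r ≤ b
          r≤b = ≡.subst (_≤ b) (≡.sym (#rooks-at inB φ))
                  (≡.subst (#rooksᴬ (at φ) ≤_) (#rooks+#rookFree≡rows φ naᴬ) (ℕ.m≤m+n _ _))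

      boardSum≈placementNumbers : boardSum a b inB ≈
        Σ≤ (a ⊓ b) (λ k → Σ≤ (a ∸ k) (λ l → placementNumber k l * Y ^ᴿ (b ∸ k) * X ^ᴿ (a ∸ k ∸ l)))
      boardSum≈placementNumbers = sym (begin
        Σ≤ (a ⊓ b) (λ k → Σ≤ (a ∸ k) (λ l → placementNumber k l * Y ^ᴿ (b ∸ k) * X ^ᴿ (a ∸ k ∸ l)))
          ≈⟨ Σ≤-cong (a ⊓ b) (λ k → trans (Σ≤-cong (a ∸ k) (placementNumber-term k)) (Σ≤-∑ (a ∸ k) (term k) P)) ⟩
        Σ≤ (a ⊓ b) (λ k → ∑ (λ φ → Σ≤ (a ∸ k) (λ l → term k l φ)) P)
          ≈⟨ Σ≤-∑ (a ⊓ b) (λ k φ → Σ≤ (a ∸ k) (λ l → term k l φ)) P ⟩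
        ∑ (λ φ → Σ≤ (a ⊓ b) (λ k → Σ≤ (a ∸ k) (λ l → term k l φ))) P
          ≈⟨ ∑-cong P Σ≤-selected ⟩
        boardSum a b inB ∎)
        where
        P = allPlacements a b
        term : ℕ → ℕ → Placement a b → Carrier
        term k l φ = if selected k l φ then monomial k l (#empty φ) b a else 0#

    expansion : ∀ w → evalWord X Y w ≈
      Σ≤ (#X w ⊓ #Y w) (λ k → Σ≤ (#X w ∸ k) (λ l → mkl μ ν q w k l * Y ^ᴿ (#Y w ∸ k) * X ^ᴿ (#X w ∸ k ∸ l)))
    expansion w = trans (evalWord≈boardSum w 0) (boardSum≈placementNumbers (inBoard w))

theorem2p6 : ∀ {c ℓ : Level} (R : Ring c ℓ) → let open Ring R in let open RingDefs R in
    (μ ν q X Y : Carrier) →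
    (∀ z → μ * z ≈ z * μ) → (∀ z → ν * z ≈ z * ν) → (∀ z → q * z ≈ z * q) →
    X * Y + - (q * (Y * X)) ≈ μ + ν * Y →
    (r : ℕ) (ns ms : Vec ℕ r) →
    evalWord X Y (blockWord ns ms) ≈
      Σ≤ (sum ms ⊓ sum ns) (λ k → Σ≤ (sum ms ∸ k) (λ l →
        mkl μ ν q (blockWord ns ms) k l * (Y ^ᴿ (sum ns ∸ k)) * (X ^ᴿ (sum ms ∸ k ∸ l))))
theorem2p6 R μ ν q X Y μ-central ν-central q-central rel r ns ms =
  subst₂ (λ a b → evalWord X Y w ≈
                   Σ≤ (a ⊓ b) (λ k → Σ≤ (a ∸ k) (λ l → mkl μ ν q w k l * Y ^ᴿ (b ∸ k) * X ^ᴿ (a ∸ k ∸ l))))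
    (Words.#X-blockWord ns ms) (Words.#Y-blockWord ns ms)
    (Expansion.expansion R μ-central ν-central q-central rel w)
  where
  open Ring R
  open RingDefs R
  w = blockWord ns ms
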